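{- For every integer $n\ge 6$, the function $g(n)=\max\{f_1(\mathcal{P}(G)) : G \text{ a graph with } n \text{ vertices}\}$ satisfies \[ \tfrac{1}{54}n^4\le g(n)\le \left(\tfrac{1}{32}+o(1)\right)n^4, \] where $o(1)\to 0$ as $n\to\infty$.
   Context: All graphs are finite, undirected, without loops, multiple edges or isolated vertices. For a graph $G$ on vertex set $[n]$, the edge polytope is $\mathcal{P}(G)=\mathrm{conv}\{e_i+e_j : \{i,j\}\in E(G)\}\subseteq\mathbb{R}^n$, where $e_i$ is the $i$th unit vector. $f_1(P)$ is the number of edges (one-dimensional faces) of a polytope $P$. -}

module Defs where

open import Data.Nat as ℕ using (ℕ; suc; _*_; _^_; _≤_)
open import Data.Fin using (Fin) renaming (_<_ to _<ᶠ_)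
open import Data.Bool using (Bool; true; false)
open import Data.Product using (Σ; ∃; _×_; _,_)
open import Data.Sum using (_⊎_)
open import Data.List using (List; length)
open import Data.List.Relation.Unary.All using (All)
open import Data.List.Relation.Unary.Unique.Propositional using (Unique)
open import Data.Rational as ℚ using (ℚ)
open import Relation.Binary.PropositionalEquality using (_≡_; _≢_)

record Graph (n : ℕ) : Set where
  field
    adj     : Fin n → Fin n → Bool
    symm    : ∀ i j → adj i j ≡ adj j i
    irrefl  : ∀ i → adj i i ≡ false
    noIsol  : ∀ i → ∃ λ j → adj i j ≡ true
open Graph public

IsGEdge : ∀ {n} → Graph n → Fin n → Fin n → Set
IsGEdge G i j = (i <ᶠ j) × (adj G i j ≡ true)

LexLt : ∀ {n} → Fin n × Fin n → Fin n × Fin n → Set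
LexLt (i , j) (k , l) = (i <ᶠ k) ⊎ ((i ≡ k) × (j <ᶠ l))

-- Value of the linear functional c on the vertex e_i + e_j of P(G).
val : ∀ {n} → (Fin n → ℚ) → Fin n → Fin n → ℚ
val c i j = c i ℚ.+ c j

-- (i , j , k , l) represents the segment conv{e_i+e_j, e_k+e_l} between two
-- distinct vertices of P(G) (unordered pair, canonically ordered).  It is a
-- one-dimensional face of P(G) iff some linear functional c (with rational
-- coefficients) attains its maximum over P(G) exactly on these two vertices.
IsPolyEdge : ∀ {n} → Graph n → Fin n × Fin n × Fin n × Fin n → Set
IsPolyEdge {n} G (i , j , k , l) =
  IsGEdge G i j × IsGEdge G k l × LexLt (i , j) (k , l) ×
  Σ (Fin n → ℚ) λ c →
    (val c i j ≡ val c k l) ×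
    (∀ a b → IsGEdge G a b → (a , b) ≢ (i , j) → (a , b) ≢ (k , l) →
       val c a b ℚ.< val c i j)

-- "f₁(P(G)) ≥ m": there is a duplicate-free list of m edges of P(G).
EdgeList : ∀ {n} → Graph n → List (Fin n × Fin n × Fin n × Fin n) → Set
EdgeList G L = Unique L × All (IsPolyEdge G) L

-- If conv{e_i + e_j, e_k + e_l} is an edge of P(G) with ij and kl disjoint, then G does
-- not contain both ik and jl (nor both il and jk): otherwise the midpoint of the segment is also the
-- midpoint of e_i + e_k and e_j + e_l.  Every edge of P(G) gives 8 ordered quadruples with this
-- property, and comparing them with closed walks i k j l yields 8 f₁ + H ≤ E² + 2n³, where E is the
-- degree sum and H the number of closed walks of length 4.  Cauchy–Schwarz gives E⁴ ≤ n⁴ H, whence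
-- 32 f₁ ≤ n⁴ + 8n³.
--
-- Take two cliques of sizes p and q and an independent set of size r joined to both.
-- Explicit vertex weights certify five families of edges of P(G): pairs of disjoint edges, one inside
-- a clique and the other inside or leaving the other clique, and pairs of edges to the independent set
-- sharing a vertex; there are about p²q²/4 + p²qr/2 + pq²r/2 of them.  For p = q ≈ 3n/7 and r ≈ n/7
-- this beats n⁴/54 (as 27/1372 > 1/54), which is checked for each residue n = 7t + c by comparing the
-- coefficients of two polynomials in t.

module Submission where

open import Defs
open import Data.Nat using (ℕ; suc; _+_; _*_; _^_; _≤_)
open import Data.Product using (Σ; ∃; _×_; _,_)
open import Data.List using (length)

open import Data.Nat using (zero; _<_; z≤n; s≤s; z<s; _<ᵇ_; _≤ᵇ_; _∸_; _%_; _/_; _<?_; _≤?_)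
open import Data.Nat.Properties
open import Data.Nat.DivMod using (m≡m%n+[m/n]*n; m%n<n)
open import Data.Nat.Tactic.RingSolver using (solve-∀)
open import Data.Fin as Fin using (Fin; zero; suc; toℕ) renaming (_<_ to _<ᶠ_)
import Data.Fin.Properties as Finₚ
open import Data.Bool using (Bool; true; false; _∧_; _∨_; not; T; if_then_else_)
import Data.Bool.Properties as Boolₚ
open import Data.Bool.Solver using (module ∨-∧-Solver)
open ∨-∧-Solver using (_:+_; _:*_; _:=_)
open import Data.Unit using (tt)
open import Data.Product using (proj₁; proj₂)
open import Data.Product.Properties using (,-injectiveˡ; ,-injectiveʳ)
open import Data.Sum using (_⊎_; inj₁; inj₂)
open import Data.Empty using (⊥; ⊥-elim)
open import Data.List using (List; []; _∷_; map; _++_; filterᵇ; allFin; cartesianProduct)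
import Data.List.Properties as Listₚ
open import Data.List.Relation.Unary.All as All using (All)
import Data.List.Relation.Unary.All.Properties as Allₚ
open import Data.List.Relation.Unary.AllPairs using ([]; _∷_)
open import Data.List.Relation.Unary.Unique.Propositional using (Unique)
import Data.List.Relation.Unary.Unique.Propositional.Properties as Uniqueₚ
open import Data.List.Membership.Propositional using (_∈_)
import Data.List.Membership.Propositional.Properties as ∈ₚ
open import Data.Integer as ℤ using (+<+)
import Data.Integer.Properties as ℤₚ
import Data.Rational as ℚ
import Data.Rational.Properties as ℚₚ
open import Data.Rational.Literals using (fromℤ)
open import Algebra.Bundles using (CommutativeMonoid)
open import Algebra.Properties.CommutativeSemigroup (CommutativeMonoid.commutativeSemigroup ℚₚ.+-0-commutativeMonoid)
  using (interchange)
open import Algebra.Properties.Semiring.Sum +-*-semiring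
  using (sum-syntax; sum-cong-≗; ∑-distrib-+; ∑-comm; *-distribˡ-sum; *-distribʳ-sum)
open import Function using (_∘_; case_of_; Equivalence)
open import Relation.Nullary using (¬_; Dec; does; yes; no)
open import Relation.Nullary.Decidable using (map′; _×-dec_; _⊎-dec_; dec-true; dec-false; T?)
open import Relation.Binary.Definitions using (DecidableEquality; tri<; tri≈; tri>)
open import Relation.Binary.PropositionalEquality

⟦_⟧ : Bool → ℕ
⟦ true ⟧ = 1
⟦ false ⟧ = 0

⟦⟧≤1 : ∀ b → ⟦ b ⟧ ≤ 1
⟦⟧≤1 true = ≤-refl
⟦⟧≤1 false = z≤n

⟦∧⟧ : ∀ a b → ⟦ a ∧ b ⟧ ≡ ⟦ a ⟧ * ⟦ b ⟧
⟦∧⟧ true b = sym (+-identityʳ ⟦ b ⟧)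
⟦∧⟧ false b = refl

does⇒ : ∀ {A : Set} (a? : Dec A) → does a? ≡ true → A
does⇒ (yes a) _ = a

⟦∨⟧-exclusive : ∀ a b → (a ≡ true → b ≡ false) → ⟦ a ∨ b ⟧ ≡ ⟦ a ⟧ + ⟦ b ⟧
⟦∨⟧-exclusive true b a⇒¬b rewrite a⇒¬b refl = refl
⟦∨⟧-exclusive false b a⇒¬b = refl

⟦does-⊎⟧ : ∀ {A B : Set} (a? : Dec A) (b? : Dec B) → (A → ¬ B) →
           ⟦ does (a? ⊎-dec b?) ⟧ ≡ ⟦ does a? ⟧ + ⟦ does b? ⟧
⟦does-⊎⟧ a? b? A⇒¬B = ⟦∨⟧-exclusive (does a?) (does b?) λ a → dec-false b? (A⇒¬B (does⇒ a? a))

2*m*n≤m²+n² : ∀ m n → 2 * (m * n) ≤ m * m + n * n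
2*m*n≤m²+n² zero n = z≤n
2*m*n≤m²+n² (suc m) zero rewrite *-zeroʳ m = z≤n
2*m*n≤m²+n² (suc m) (suc n) =
  subst₂ _≤_ (step m n) (step′ m n) (+-monoˡ-≤ (2 * m + 2 * n + 2) (2*m*n≤m²+n² m n))
  where
  step : ∀ m n → 2 * (m * n) + (2 * m + 2 * n + 2) ≡ 2 * (suc m * suc n)
  step = solve-∀
  step′ : ∀ m n → m * m + n * n + (2 * m + 2 * n + 2) ≡ suc m * suc m + suc n * suc n
  step′ = solve-∀

-- P T ≤ P F − F² + P m, and P F − F² ≤ P²/4.
quadratic-bound : ∀ P T H F m → T + H ≤ F + m → F * F ≤ P * H → 4 * T ≤ P + 4 * m
quadratic-bound zero T H zero m T+H≤m _ = *-monoʳ-≤ 4 (≤-trans (m≤m+n T H) T+H≤m)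
quadratic-bound P@(suc _) T H F m T+H≤F+m F²≤PH = *-cancelˡ-≤ P (+-cancelʳ-≤ (4 * (F * F)) _ _ (begin
  P * (4 * T) + 4 * (F * F)        ≤⟨ +-monoʳ-≤ (P * (4 * T)) (*-monoʳ-≤ 4 F²≤PH) ⟩
  P * (4 * T) + 4 * (P * H)        ≡⟨ factor P T H ⟩
  4 * P * (T + H)                  ≤⟨ *-monoʳ-≤ (4 * P) T+H≤F+m ⟩
  4 * P * (F + m)                  ≡⟨ expand P F m ⟩
  2 * (P * (2 * F)) + 4 * (P * m)  ≤⟨ +-monoˡ-≤ (4 * (P * m)) (2*m*n≤m²+n² P (2 * F)) ⟩
  P * P + 2 * F * (2 * F) + 4 * (P * m) ≡⟨ collect P F m ⟩
  P * (P + 4 * m) + 4 * (F * F)    ∎))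
  where
  open ≤-Reasoning
  factor : ∀ P T H → P * (4 * T) + 4 * (P * H) ≡ 4 * P * (T + H)
  factor = solve-∀
  expand : ∀ P F m → 4 * P * (F + m) ≡ 2 * (P * (2 * F)) + 4 * (P * m)
  expand = solve-∀
  collect : ∀ P F m → P * P + 2 * F * (2 * F) + 4 * (P * m) ≡ P * (P + 4 * m) + 4 * (F * F)
  collect = solve-∀

same : ∀ {n} → Fin n → Fin n → Bool
same x y = does (x Fin.≟ y)

same-comm : ∀ {n} (x y : Fin n) → same x y ≡ same y x
same-comm x y with x Fin.≟ y
... | yes refl = sym (dec-true (x Fin.≟ x) refl)
... | no x≢y = sym (dec-false (y Fin.≟ x) (x≢y ∘ sym))

same-refl : ∀ {n} (x : Fin n) → same x x ≡ true
same-refl x = dec-true (x Fin.≟ x) refl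

same-≢ : ∀ {n} {x y : Fin n} → x ≢ y → same x y ≡ false
same-≢ {x = x} {y} = dec-false (x Fin.≟ y)

∑-cong : ∀ {n} {f g : Fin n → ℕ} → (∀ i → f i ≡ g i) → ∑[ i < n ] f i ≡ ∑[ i < n ] g i
∑-cong = sum-cong-≗

∑-zero : ∀ n → ∑[ i < n ] 0 ≡ 0
∑-zero zero = refl
∑-zero (suc n) = ∑-zero n

∑-const : ∀ n c → ∑[ i < n ] c ≡ n * c
∑-const zero c = refl
∑-const (suc n) c = cong (c +_) (∑-const n c)

∑-mono-≤ : ∀ {n} {f g : Fin n → ℕ} → (∀ i → f i ≤ g i) → ∑[ i < n ] f i ≤ ∑[ i < n ] g i
∑-mono-≤ {zero} f≤g = z≤n
∑-mono-≤ {suc n} f≤g = +-mono-≤ (f≤g zero) (∑-mono-≤ (f≤g ∘ suc))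

∑-δ : ∀ {n} (a : Fin n) → ∑[ i < n ] ⟦ same i a ⟧ ≡ 1
∑-δ {suc n} zero = cong suc (∑-zero n)
∑-δ {suc n} (suc a) = ∑-δ a

∑-*ˡ : ∀ {n} c (f : Fin n → ℕ) → ∑[ i < n ] (c * f i) ≡ c * ∑[ i < n ] f i
∑-*ˡ c f = sym (*-distribˡ-sum c f)

∑-*ʳ : ∀ {n} c (f : Fin n → ℕ) → ∑[ i < n ] (f i * c) ≡ (∑[ i < n ] f i) * c
∑-*ʳ c f = sym (*-distribʳ-sum c f)

∑-δ-* : ∀ {n} (a : Fin n) c → ∑[ i < n ] (⟦ same i a ⟧ * c) ≡ c
∑-δ-* a c = trans (∑-*ʳ c λ i → ⟦ same i a ⟧) (trans (cong (_* c) (∑-δ a)) (+-identityʳ c))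

∑∑-*ˡ : ∀ {m n} c (f : Fin m → Fin n → ℕ) →
        ∑[ i < m ] ∑[ j < n ] (c * f i j) ≡ c * ∑[ i < m ] ∑[ j < n ] f i j
∑∑-*ˡ {m} {n} c f = trans (∑-cong λ i → ∑-*ˡ c (f i)) (∑-*ˡ c λ i → ∑[ j < n ] f i j)

∑∑-*ʳ : ∀ {m n} c (f : Fin m → Fin n → ℕ) →
        ∑[ i < m ] ∑[ j < n ] (f i j * c) ≡ (∑[ i < m ] ∑[ j < n ] f i j) * c
∑∑-*ʳ {m} {n} c f = trans (∑-cong λ i → ∑-*ʳ c (f i)) (∑-*ʳ c λ i → ∑[ j < n ] f i j)

∑∑-separable : ∀ {m n} (f : Fin m → ℕ) (g : Fin n → ℕ) →
               ∑[ i < m ] ∑[ j < n ] (f i * g j) ≡ (∑[ i < m ] f i) * (∑[ j < n ] g j)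
∑∑-separable f g = trans (∑-cong λ i → ∑-*ˡ (f i) g) (∑-*ʳ _ f)

Cauchy-Schwarz : ∀ n (f : Fin n → ℕ) →
                 (∑[ i < n ] f i) * (∑[ i < n ] f i) ≤ n * ∑[ i < n ] (f i * f i)
Cauchy-Schwarz zero f = z≤n
Cauchy-Schwarz (suc n) f = begin
  (x + S) * (x + S)                 ≡⟨ square-+ x S ⟩
  x * x + 2 * (x * S) + S * S       ≤⟨ +-mono-≤ (+-monoʳ-≤ (x * x) (cross n S S≤)) S≤ ⟩
  x * x + (Q + n * (x * x)) + n * Q ≡⟨ regroup n x Q ⟩
  suc n * (x * x + Q)               ∎
  where
  open ≤-Reasoning
  x S Q : ℕ
  x = f zero
  S = ∑[ i < n ] f (suc i)
  Q = ∑[ i < n ] (f (suc i) * f (suc i))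
  S≤ : S * S ≤ n * Q
  S≤ = Cauchy-Schwarz n (f ∘ suc)
  square-+ : ∀ x S → (x + S) * (x + S) ≡ x * x + 2 * (x * S) + S * S
  square-+ = solve-∀
  regroup : ∀ n x Q → x * x + (Q + n * (x * x)) + n * Q ≡ suc n * (x * x + Q)
  regroup = solve-∀
  cross : ∀ n S → S * S ≤ n * Q → 2 * (x * S) ≤ Q + n * (x * x)
  cross zero zero _ rewrite *-zeroʳ x = z≤n
  cross (suc n) S S*S≤nQ = *-cancelˡ-≤ (suc n) (begin
    suc n * (2 * (x * S))                 ≡⟨ rearrange (suc n) x S ⟩
    2 * (S * (suc n * x))                 ≤⟨ 2*m*n≤m²+n² S (suc n * x) ⟩
    S * S + suc n * x * (suc n * x)       ≤⟨ +-monoˡ-≤ _ S*S≤nQ ⟩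
    suc n * Q + suc n * x * (suc n * x)   ≡⟨ factor (suc n) x Q ⟩
    suc n * (Q + suc n * (x * x))         ∎)
    where
    rearrange : ∀ m x S → m * (2 * (x * S)) ≡ 2 * (S * (m * x))
    rearrange = solve-∀
    factor : ∀ m x Q → m * Q + m * x * (m * x) ≡ m * (Q + m * (x * x))
    factor = solve-∀

Cauchy-Schwarz₂ : ∀ m n (f : Fin m → Fin n → ℕ) →
  (∑[ i < m ] ∑[ j < n ] f i j) * (∑[ i < m ] ∑[ j < n ] f i j) ≤ m * (n * ∑[ i < m ] ∑[ j < n ] (f i j * f i j))
Cauchy-Schwarz₂ m n f = begin
  (∑[ i < m ] row i) * (∑[ i < m ] row i)         ≤⟨ Cauchy-Schwarz m row ⟩
  m * ∑[ i < m ] (row i * row i)                  ≤⟨ *-monoʳ-≤ m (∑-mono-≤ λ i → Cauchy-Schwarz n (f i)) ⟩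
  m * ∑[ i < m ] (n * ∑[ j < n ] (f i j * f i j)) ≡⟨ cong (m *_) (∑-*ˡ n λ i → ∑[ j < n ] (f i j * f i j)) ⟩
  m * (n * ∑[ i < m ] ∑[ j < n ] (f i j * f i j)) ∎
  where
  open ≤-Reasoning
  row : Fin m → ℕ
  row i = ∑[ j < n ] f i j

Quad : ℕ → Set
Quad n = Fin n × Fin n × Fin n × Fin n

∑₄ : ∀ {n} → (Quad n → ℕ) → ℕ
∑₄ {n} f = ∑[ i < n ] ∑[ j < n ] ∑[ k < n ] ∑[ l < n ] f (i , j , k , l)

module _ {n : ℕ} where

  ∑₄-cong : {f g : Quad n → ℕ} → (∀ q → f q ≡ g q) → ∑₄ f ≡ ∑₄ g
  ∑₄-cong f≗g =
    ∑-cong λ i → ∑-cong λ j → ∑-cong λ k → ∑-cong λ l → f≗g (i , j , k , l)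

  ∑₄-mono-≤ : {f g : Quad n → ℕ} → (∀ q → f q ≤ g q) → ∑₄ f ≤ ∑₄ g
  ∑₄-mono-≤ f≤g = ∑-mono-≤ λ i → ∑-mono-≤ λ j → ∑-mono-≤ λ k → ∑-mono-≤ λ l → f≤g (i , j , k , l)

  ∑₄-distrib-+ : (f g : Quad n → ℕ) → ∑₄ (λ q → f q + g q) ≡ ∑₄ f + ∑₄ g
  ∑₄-distrib-+ f g = ∑-+ λ i → ∑-+ λ j → ∑-+ λ k → ∑-+ λ l → refl
    where
    ∑-+ : {h f g : Fin n → ℕ} → (∀ i → h i ≡ f i + g i) → ∑[ i < n ] h i ≡ ∑[ i < n ] f i + ∑[ i < n ] g i
    ∑-+ {f = f} {g} h≗f+g = trans (∑-cong h≗f+g) (∑-distrib-+ f g)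

  ∑₄-zero : ∑₄ {n} (λ _ → 0) ≡ 0
  ∑₄-zero = ∑-cong₀ λ i → ∑-cong₀ λ j → ∑-cong₀ λ k → ∑-zero n
    where
    ∑-cong₀ : {f : Fin n → ℕ} → (∀ i → f i ≡ 0) → ∑[ i < n ] f i ≡ 0
    ∑-cong₀ f≗0 = trans (∑-cong f≗0) (∑-zero n)

  ∑₄-separable : (f g : Fin n → Fin n → ℕ) →
    ∑₄ (λ { (i , j , k , l) → f i j * g k l }) ≡ (∑[ i < n ] ∑[ j < n ] f i j) * (∑[ k < n ] ∑[ l < n ] g k l)
  ∑₄-separable f g = trans (∑-cong λ i → ∑-cong λ j → ∑∑-*ˡ (f i j) g) (∑∑-*ʳ _ f)

  ∑₄-same₁₄ : ∑₄ {n} (λ { (i , j , k , l) → ⟦ same l i ⟧ }) ≡ n ^ 3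
  ∑₄-same₁₄ =
    trans (∑-cong {n} λ i → trans (∑-cong {n} λ j → trans (∑-cong {n} λ k → ∑-δ i)
      (∑-const n 1)) (∑-const n (n * 1))) (∑-const n (n * (n * 1)))

  ∑₄-same₂₃ : ∑₄ {n} (λ { (i , j , k , l) → ⟦ same k j ⟧ }) ≡ n ^ 3
  ∑₄-same₂₃ =
    trans (∑-cong {n} λ i → trans (∑-cong {n} λ j →
      trans (∑-cong {n} λ k → ∑-const n ⟦ same k j ⟧) (trans (∑-*ˡ n λ k → ⟦ same k j ⟧) (cong (n *_) (∑-δ j))))
      (∑-const n (n * 1))) (∑-const n (n * (n * 1)))

  ∑₄-shared₂₄ : (f : Fin n → Fin n → ℕ) (g : Fin n → ℕ) →
    ∑₄ (λ { (i , j , k , l) → f i k * (g j * ⟦ same l j ⟧) }) ≡ (∑[ i < n ] ∑[ k < n ] f i k) * ∑[ j < n ] g j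
  ∑₄-shared₂₄ f g = begin
    ∑[ i < n ] ∑[ j < n ] ∑[ k < n ] ∑[ l < n ] (f i k * (g j * ⟦ same l j ⟧))
      ≡⟨ ∑-cong (λ i → ∑-cong λ j → ∑-cong λ k → collapse (f i k) j) ⟩
    ∑[ i < n ] ∑[ j < n ] ∑[ k < n ] (f i k * g j)  ≡⟨ ∑-cong (λ i → ∑-comm λ j k → f i k * g j) ⟩
    ∑[ i < n ] ∑[ k < n ] ∑[ j < n ] (f i k * g j)  ≡⟨ ∑-cong (λ i → ∑-cong λ k → ∑-*ˡ (f i k) g) ⟩
    ∑[ i < n ] ∑[ k < n ] (f i k * ∑[ j < n ] g j)  ≡⟨ ∑∑-*ʳ _ f ⟩
    (∑[ i < n ] ∑[ k < n ] f i k) * ∑[ j < n ] g j  ∎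
    where
    open ≡-Reasoning
    collapse : ∀ c j → ∑[ l < n ] (c * (g j * ⟦ same l j ⟧)) ≡ c * g j
    collapse c j = trans (∑-*ˡ c λ l → g j * ⟦ same l j ⟧)
      (cong (c *_) (trans (∑-*ˡ (g j) λ l → ⟦ same l j ⟧) (trans (cong (g j *_) (∑-δ j)) (*-identityʳ (g j)))))

  ∑₄-shared₁₃ : (f : Fin n → ℕ) (g : Fin n → Fin n → ℕ) →
    ∑₄ (λ { (i , j , k , l) → f i * ⟦ same k i ⟧ * g j l }) ≡ (∑[ i < n ] f i) * ∑[ j < n ] ∑[ l < n ] g j l
  ∑₄-shared₁₃ f g = begin
    ∑[ i < n ] ∑[ j < n ] ∑[ k < n ] ∑[ l < n ] (f i * ⟦ same k i ⟧ * g j l)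
      ≡⟨ ∑-cong (λ i → ∑-cong λ j → ∑-cong λ k → ∑-*ˡ (f i * ⟦ same k i ⟧) (g j)) ⟩
    ∑[ i < n ] ∑[ j < n ] ∑[ k < n ] (f i * ⟦ same k i ⟧ * ∑[ l < n ] g j l)
      ≡⟨ ∑-cong (λ i → ∑-cong λ j → trans (∑-*ʳ (∑[ l < n ] g j l) λ k → f i * ⟦ same k i ⟧)
                                          (cong (_* ∑[ l < n ] g j l) (collapse i))) ⟩
    ∑[ i < n ] ∑[ j < n ] (f i * ∑[ l < n ] g j l)  ≡⟨ ∑∑-separable f (λ j → ∑[ l < n ] g j l) ⟩
    (∑[ i < n ] f i) * ∑[ j < n ] ∑[ l < n ] g j l  ∎
    where
    open ≡-Reasoning
    collapse : ∀ i → ∑[ k < n ] (f i * ⟦ same k i ⟧) ≡ f i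
    collapse i = trans (∑-*ˡ (f i) λ k → ⟦ same k i ⟧) (trans (cong (f i *_) (∑-δ i)) (*-identityʳ (f i)))

  _≟₄_ : DecidableEquality (Quad n)
  (i , j , k , l) ≟₄ (i′ , j′ , k′ , l′) =
    map′ (λ { (refl , refl , refl , refl) → refl }) (λ { refl → refl , refl , refl , refl })
      (i Fin.≟ i′ ×-dec j Fin.≟ j′ ×-dec k Fin.≟ k′ ×-dec l Fin.≟ l′)

  ∑₄-δ : (a : Quad n) → ∑₄ (λ q → ⟦ does (q ≟₄ a) ⟧) ≡ 1
  ∑₄-δ (a , b , c , d) = trans (∑₄-cong λ (i , j , k , l) → ⟦∧⟧₄ (same i a) (same j b) (same k c) (same l d))
    (trans (∑-cong λ i → trans (∑-cong λ j → trans (∑-cong λ k →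
      ∑-δ-* d (⟦ same k c ⟧ * (⟦ same j b ⟧ * ⟦ same i a ⟧)))
      (∑-δ-* c (⟦ same j b ⟧ * ⟦ same i a ⟧)))
      (∑-δ-* b ⟦ same i a ⟧))
      (∑-δ a))
    where
    ⟦∧⟧₄ : ∀ w x y z → ⟦ w ∧ x ∧ y ∧ z ⟧ ≡ ⟦ z ⟧ * (⟦ y ⟧ * (⟦ x ⟧ * ⟦ w ⟧))
    ⟦∧⟧₄ w x y z rewrite ⟦∧⟧ w (x ∧ y ∧ z) | ⟦∧⟧ x (y ∧ z) | ⟦∧⟧ y z =
      reverse ⟦ w ⟧ ⟦ x ⟧ ⟦ y ⟧ ⟦ z ⟧
      where reverse : ∀ w x y z → w * (x * (y * z)) ≡ z * (y * (x * w))
            reverse = solve-∀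

  open import Data.List.Membership.DecPropositional _≟₄_ using (_∈?_)

  ∑₄-∈ : {xs : List (Quad n)} → Unique xs → ∑₄ (λ q → ⟦ does (q ∈? xs) ⟧) ≡ length xs
  ∑₄-∈ [] = ∑₄-zero
  ∑₄-∈ {x ∷ xs} (x≢xs ∷ u) = trans (∑₄-cong split)
    (trans (∑₄-distrib-+ _ _) (cong₂ _+_ (∑₄-δ x) (∑₄-∈ u)))
    where
    split : ∀ q → ⟦ does (q ∈? x ∷ xs) ⟧ ≡ ⟦ does (q ≟₄ x) ⟧ + ⟦ does (q ∈? xs) ⟧
    split q = ⟦∨⟧-exclusive (does (q ≟₄ x)) (does (q ∈? xs)) λ q≟x → dec-false (q ∈? xs) λ q∈xs →
      All.lookup x≢xs (subst (_∈ xs) (does⇒ (q ≟₄ x) q≟x) q∈xs) refl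

  length≤∑₄ : (P : Quad n → Bool) {xs : List (Quad n)} → Unique xs → All (λ q → P q ≡ true) xs →
              length xs ≤ ∑₄ (⟦_⟧ ∘ P)
  length≤∑₄ P {xs} u Pxs = subst (_≤ ∑₄ (⟦_⟧ ∘ P)) (∑₄-∈ u) (∑₄-mono-≤ bound)
    where
    bound : ∀ q → ⟦ does (q ∈? xs) ⟧ ≤ ⟦ P q ⟧
    bound q with q ∈? xs
    ... | yes q∈xs rewrite All.lookup Pxs q∈xs = ≤-refl
    ... | no _ = z≤n

  allQuads : List (Quad n)
  allQuads = cartesianProduct (allFin n) (cartesianProduct (allFin n) (cartesianProduct (allFin n) (allFin n)))

  allQuads-complete : ∀ q → q ∈ allQuads
  allQuads-complete (i , j , k , l) = ∈ₚ.∈-cartesianProduct⁺ (∈ₚ.∈-allFin i)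
    (∈ₚ.∈-cartesianProduct⁺ (∈ₚ.∈-allFin j) (∈ₚ.∈-cartesianProduct⁺ (∈ₚ.∈-allFin k) (∈ₚ.∈-allFin l)))

  allQuads-unique : Unique allQuads
  allQuads-unique = Uniqueₚ.cartesianProduct⁺ (Uniqueₚ.allFin⁺ n)
    (Uniqueₚ.cartesianProduct⁺ (Uniqueₚ.allFin⁺ n)
      (Uniqueₚ.cartesianProduct⁺ (Uniqueₚ.allFin⁺ n) (Uniqueₚ.allFin⁺ n)))

  length-filter-allQuads : (P : Quad n → Bool) → length (filterᵇ P allQuads) ≡ ∑₄ (⟦_⟧ ∘ P)
  length-filter-allQuads P = trans (sym (∑₄-∈ (Uniqueₚ.filter⁺ (T? ∘ P) allQuads-unique))) (∑₄-cong member)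
    where
    member : ∀ q → ⟦ does (q ∈? filterᵇ P allQuads) ⟧ ≡ ⟦ P q ⟧
    member q with P q in Pq
    ... | true = cong ⟦_⟧ (dec-true (q ∈? _) (∈ₚ.∈-filter⁺ (T? ∘ P) (allQuads-complete q) (subst T (sym Pq) tt)))
    ... | false = cong ⟦_⟧ (dec-false (q ∈? _) λ q∈ →
      subst T Pq (proj₂ (∈ₚ.∈-filter⁻ (T? ∘ P) {xs = allQuads} q∈)))

module _ {A : Set} (σ : A → A) where

  unique-++-map : (∀ {x y} → σ x ≡ σ y → x ≡ y) → {P : A → Set} → (∀ {x} → P x → ¬ P (σ x)) →
                  ∀ {xs} → Unique xs → All P xs → Unique (xs ++ map σ xs)
  unique-++-map σ-injective P⇒¬Pσ {xs} u Pxs = Uniqueₚ.++⁺ u (Uniqueₚ.map⁺ σ-injective u) disjoint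
    where
    disjoint : ∀ {v} → ¬ (v ∈ xs × v ∈ map σ xs)
    disjoint (v∈xs , v∈σxs) with ∈ₚ.∈-map⁻ σ v∈σxs
    ... | x , x∈xs , refl = P⇒¬Pσ (All.lookup Pxs x∈xs) (All.lookup Pxs v∈xs)

  all-++-map : {P : A → Set} → (∀ {x} → P x → P (σ x)) → ∀ {xs} → All P xs → All P (xs ++ map σ xs)
  all-++-map P⇒Pσ Pxs = Allₚ.++⁺ Pxs (Allₚ.map⁺ (All.map P⇒Pσ Pxs))

  length-++-map : ∀ xs → length (xs ++ map σ xs) ≡ length xs + length xs
  length-++-map xs = trans (Listₚ.length-++ xs) (cong (length xs +_) (Listₚ.length-map σ xs))

-- The upper bound

sharesVertex : ∀ {n} → Quad n → Bool
sharesVertex (i , j , k , l) = same i k ∨ same i l ∨ same j k ∨ same j l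

swapEdges flipFirst flipSecond : ∀ {n} → Quad n → Quad n
swapEdges (i , j , k , l) = k , l , i , j
flipFirst (i , j , k , l) = j , i , k , l
flipSecond (i , j , k , l) = i , j , l , k

module _ {n : ℕ} (G : Graph n) where

  crossLinked : Quad n → Bool
  crossLinked (i , j , k , l) = adj G i k ∧ adj G j l ∨ adj G i l ∧ adj G j k

  candidate : Quad n → Bool
  candidate q@(i , j , k , l) = adj G i j ∧ adj G k l ∧ (sharesVertex q ∨ not (crossLinked q))

  candidate-swapEdges : ∀ q → candidate (swapEdges q) ≡ candidate q
  candidate-swapEdges (i , j , k , l)
    rewrite same-comm k i | same-comm k j | same-comm l i | same-comm l j
          | symm G k i | symm G l j | symm G k j | symm G l i | Boolₚ.∧-comm (adj G j k) (adj G i l) =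
    ∨-∧-Solver.solve 7 (λ a b x y z w u → b :* (a :* ((x :+ (z :+ (y :+ w))) :+ u))
                                       := a :* (b :* ((x :+ (y :+ (z :+ w))) :+ u))) refl
      (adj G i j) (adj G k l) (same i k) (same i l) (same j k) (same j l)
      (not (adj G i k ∧ adj G j l ∨ adj G i l ∧ adj G j k))

  candidate-flipFirst : ∀ q → candidate (flipFirst q) ≡ candidate q
  candidate-flipFirst (i , j , k , l)
    rewrite symm G j i | Boolₚ.∧-comm (adj G j k) (adj G i l) | Boolₚ.∧-comm (adj G j l) (adj G i k)
          | Boolₚ.∨-comm (adj G i l ∧ adj G j k) (adj G i k ∧ adj G j l) =
    ∨-∧-Solver.solve 7 (λ a b x y z w u → a :* (b :* ((z :+ (w :+ (x :+ y))) :+ u))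
                                       := a :* (b :* ((x :+ (y :+ (z :+ w))) :+ u))) refl
      (adj G i j) (adj G k l) (same i k) (same i l) (same j k) (same j l)
      (not (adj G i k ∧ adj G j l ∨ adj G i l ∧ adj G j k))

  candidate-flipSecond : ∀ q → candidate (flipSecond q) ≡ candidate q
  candidate-flipSecond (i , j , k , l)
    rewrite symm G l k | Boolₚ.∨-comm (adj G i l ∧ adj G j k) (adj G i k ∧ adj G j l) =
    ∨-∧-Solver.solve 7 (λ a b x y z w u → a :* (b :* ((y :+ (x :+ (w :+ z))) :+ u))
                                       := a :* (b :* ((x :+ (y :+ (z :+ w))) :+ u))) refl
      (adj G i j) (adj G k l) (same i k) (same i l) (same j k) (same j l)
      (not (adj G i k ∧ adj G j l ∨ adj G i l ∧ adj G j k))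

  module _ {i j k l : Fin n} {c : Fin n → ℚ.ℚ} (tie : val c i j ≡ val c k l)
    (maximal : ∀ a b → IsGEdge G a b → (a , b) ≢ (i , j) → (a , b) ≢ (k , l) → val c a b ℚ.< val c i j)
    where

    strictlyBelow : ∀ {a b} → adj G a b ≡ true → a ≢ k → a ≢ l → b ≢ i → b ≢ j → val c a b ℚ.< val c i j
    strictlyBelow {a} {b} ab a≢k a≢l b≢i b≢j with Finₚ.<-cmp a b
    ... | tri< a<b _ _ = maximal a b (a<b , ab) (b≢j ∘ ,-injectiveʳ) (a≢k ∘ ,-injectiveˡ)
    ... | tri≈ _ refl _ = case trans (sym ab) (irrefl G a) of λ ()
    ... | tri> _ _ b<a = subst (ℚ._< val c i j) (ℚₚ.+-comm (c b) (c a))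
      (maximal b a (b<a , trans (symm G b a) ab) (b≢i ∘ ,-injectiveˡ) (a≢l ∘ ,-injectiveʳ))

    noAlternatingSquare : i ≢ k → i ≢ l → j ≢ k → j ≢ l → ∀ {a b} → val c a b ≡ val c k l →
      a ≢ i → a ≢ j → b ≢ i → b ≢ j → adj G i a ≡ true → adj G j b ≡ true → ⊥
    noAlternatingSquare i≢k i≢l j≢k j≢l {a} {b} ab~kl a≢i a≢j b≢i b≢j ia jb =
      ℚₚ.<-irrefl square (ℚₚ.+-mono-< (strictlyBelow ia i≢k i≢l a≢i a≢j) (strictlyBelow jb j≢k j≢l b≢i b≢j))
      where
      square : val c i a ℚ.+ val c j b ≡ val c i j ℚ.+ val c i j
      square = trans (interchange (c i) (c a) (c j) (c b)) (cong (val c i j ℚ.+_) (trans ab~kl (sym tie)))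

  polyEdge⇒candidate : ∀ {q} → IsPolyEdge G q → candidate q ≡ true
  polyEdge⇒candidate {i , j , k , l} ((_ , ij) , (_ , kl) , _ , c , tie , maximal)
    rewrite ij | kl with i Fin.≟ k | i Fin.≟ l | j Fin.≟ k | j Fin.≟ l
  ... | yes _ | _ | _ | _ = refl
  ... | no _ | yes _ | _ | _ = refl
  ... | no _ | no _ | yes _ | _ = refl
  ... | no _ | no _ | no _ | yes _ = refl
  ... | no i≢k | no i≢l | no j≢k | no j≢l = cong not (cong₂ _∨_
    (∧≡false (square {k} {l} refl (≢-sym i≢k) (≢-sym j≢k) (≢-sym i≢l) (≢-sym j≢l)))
    (∧≡false (square {l} {k} (ℚₚ.+-comm (c l) (c k)) (≢-sym i≢l) (≢-sym j≢l) (≢-sym i≢k) (≢-sym j≢k))))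
    where
    square = noAlternatingSquare {i} {j} {k} {l} {c} tie maximal i≢k i≢l j≢k j≢l
    ∧≡false : ∀ {x y} → (x ≡ true → y ≡ true → ⊥) → x ∧ y ≡ false
    ∧≡false {false} _ = refl
    ∧≡false {true} {false} _ = refl
    ∧≡false {true} {true} ¬both = ⊥-elim (¬both refl refl)

  Ordered : Quad n → Set
  Ordered (i , j , k , l) = i <ᶠ j × k <ᶠ l

  eightfold : ∀ {L} → EdgeList G L → 8 * length L ≤ ∑₄ (⟦_⟧ ∘ candidate)
  eightfold {L} (uniqueL , edgesL) =
    subst (_≤ ∑₄ (⟦_⟧ ∘ candidate)) length₈ (length≤∑₄ candidate unique₈ candidates₈)
    where
    L₂ L₄ L₈ : List (Quad n)
    L₂ = L ++ map swapEdges L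
    L₄ = L₂ ++ map flipFirst L₂
    L₈ = L₄ ++ map flipSecond L₄

    ordered₂ : All Ordered L₂
    ordered₂ = all-++-map swapEdges (λ (i<j , k<l) → k<l , i<j) (All.map (λ ((i<j , _) , (k<l , _) , _) → i<j , k<l) edgesL)

    unique₈ : Unique L₈
    unique₈ = unique-++-map flipSecond (cong flipSecond) Finₚ.<-asym
      (unique-++-map flipFirst (cong flipFirst) Finₚ.<-asym
        (unique-++-map swapEdges (cong swapEdges) lex-asym uniqueL (All.map (proj₁ ∘ proj₂ ∘ proj₂) edgesL))
        (All.map proj₁ ordered₂))
      (all-++-map flipFirst (λ k<l → k<l) (All.map proj₂ ordered₂))
      where
      lex-asym : ∀ {a b : Fin n × Fin n} → LexLt a b → ¬ LexLt b a
      lex-asym (inj₁ i<k) (inj₁ k<i) = Finₚ.<-asym i<k k<i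
      lex-asym (inj₁ i<k) (inj₂ (refl , _)) = Finₚ.<-irrefl refl i<k
      lex-asym (inj₂ (refl , _)) (inj₁ k<i) = Finₚ.<-irrefl refl k<i
      lex-asym (inj₂ (refl , j<l)) (inj₂ (_ , l<j)) = Finₚ.<-asym j<l l<j

    candidates₈ : All (λ q → candidate q ≡ true) L₈
    candidates₈ =
      all-++-map flipSecond (trans (candidate-flipSecond _))
        (all-++-map flipFirst (trans (candidate-flipFirst _))
          (all-++-map swapEdges (trans (candidate-swapEdges _)) (All.map polyEdge⇒candidate edgesL)))

    length₈ : length L₈ ≡ 8 * length L
    length₈ rewrite length-++-map flipSecond L₄ | length-++-map flipFirst L₂ | length-++-map swapEdges L =
      eight (length L)
      where eight : ∀ m → m + m + (m + m) + (m + m + (m + m)) ≡ 8 * m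
            eight = solve-∀

  A : Fin n → Fin n → ℕ
  A i j = ⟦ adj G i j ⟧

  degree : Fin n → ℕ
  degree j = ∑[ i < n ] A i j

  codegree : Fin n → Fin n → ℕ
  codegree i l = ∑[ j < n ] (A i j * A j l)

  twiceEdges : ℕ
  twiceEdges = ∑[ i < n ] ∑[ j < n ] A i j

  closedWalks₄ : ℕ
  closedWalks₄ = ∑[ i < n ] ∑[ l < n ] (codegree i l * codegree i l)

  -- When i k j l is a closed walk, a candidate pair must share a vertex, and as ik and jl
  -- are edges this can only happen through i = l or j = k.
  candidate-bound : ∀ i j k l →
    ⟦ candidate (i , j , k , l) ⟧ + A i j * A k l * A i k * A j l ≤ A i j * A k l + ⟦ same l i ⟧ + ⟦ same k j ⟧
  candidate-bound i j k l rewrite same-comm l i | same-comm k j =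
    indicator (adj G i j) (adj G k l) (adj G i k) (adj G j l) (adj G i l) (adj G j k)
      (same i k) (same i l) (same j k) (same j l) (loopless i k) (loopless j l)
    where
    loopless : ∀ x y → same x y ≡ true → adj G x y ≡ false
    loopless x y x≟y rewrite does⇒ (x Fin.≟ y) x≟y = irrefl G y
    at-most-one : ∀ a y z → ⟦ a ⟧ + 0 ≤ 1 + ⟦ y ⟧ + ⟦ z ⟧
    at-most-one a y z = ≤-trans (≤-reflexive (+-identityʳ ⟦ a ⟧)) (≤-trans (⟦⟧≤1 a) (m≤m+n 1 (⟦ y ⟧ + ⟦ z ⟧)))
    indicator : ∀ a b c d e f x y z w → (x ≡ true → c ≡ false) → (w ≡ true → d ≡ false) →
      ⟦ a ∧ b ∧ ((x ∨ y ∨ z ∨ w) ∨ not (c ∧ d ∨ e ∧ f)) ⟧ + ⟦ a ⟧ * ⟦ b ⟧ * ⟦ c ⟧ * ⟦ d ⟧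
        ≤ ⟦ a ⟧ * ⟦ b ⟧ + ⟦ y ⟧ + ⟦ z ⟧
    indicator false b c d e f x y z w _ _ = z≤n
    indicator true false c d e f x y z w _ _ = z≤n
    indicator true true false d e f x y z w _ _ = at-most-one _ y z
    indicator true true true false e f x y z w _ _ = at-most-one _ y z
    indicator true true true true e f true y z w x⇒¬c _ = case x⇒¬c refl of λ ()
    indicator true true true true e f false y z true _ w⇒¬d = case w⇒¬d refl of λ ()
    indicator true true true true e f false true z false _ _ = s≤s (m≤m+n 1 ⟦ z ⟧)
    indicator true true true true e f false false true false _ _ = ≤-refl
    indicator true true true true e f false false false false _ _ = s≤s z≤n

  ∑₄-squares : ∑₄ (λ { (i , j , k , l) → A i j * A k l * A i k * A j l }) ≡ closedWalks₄
  ∑₄-squares = ∑-cong λ i →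
    trans (∑-cong λ j → ∑-comm (λ k l → A i j * A k l * A i k * A j l))
    (trans (∑-comm λ j l → ∑[ k < n ] (A i j * A k l * A i k * A j l))
    (∑-cong λ l → trans (∑-cong λ j → ∑-cong λ k → regroup (A i j) (A k l) (A i k) (A j l))
      (∑∑-separable (λ j → A i j * A j l) (λ k → A i k * A k l))))
    where
    regroup : ∀ a b c d → a * b * c * d ≡ (a * d) * (c * b)
    regroup = solve-∀

  candidates+closedWalks≤ : ∑₄ (⟦_⟧ ∘ candidate) + closedWalks₄ ≤ twiceEdges * twiceEdges + (n ^ 3 + n ^ 3)
  candidates+closedWalks≤ = begin
    ∑₄ (⟦_⟧ ∘ candidate) + closedWalks₄          ≡⟨ cong (∑₄ (⟦_⟧ ∘ candidate) +_) ∑₄-squares ⟨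
    ∑₄ (⟦_⟧ ∘ candidate) + ∑₄ square             ≡⟨ ∑₄-distrib-+ (⟦_⟧ ∘ candidate) square ⟨
    ∑₄ (λ q → ⟦ candidate q ⟧ + square q)       ≤⟨ ∑₄-mono-≤ (λ (i , j , k , l) → candidate-bound i j k l) ⟩
    ∑₄ (λ q → edgePair q + δ₁₄ q + δ₂₃ q)       ≡⟨ ∑₄-distrib-+ (λ q → edgePair q + δ₁₄ q) δ₂₃ ⟩
    ∑₄ (λ q → edgePair q + δ₁₄ q) + ∑₄ δ₂₃       ≡⟨ cong₂ _+_ (∑₄-distrib-+ edgePair δ₁₄) (∑₄-same₂₃ {n}) ⟩
    ∑₄ edgePair + ∑₄ δ₁₄ + n ^ 3                  ≡⟨ cong₂ (λ x y → x + y + n ^ 3) (∑₄-separable A A) (∑₄-same₁₄ {n}) ⟩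
    twiceEdges * twiceEdges + n ^ 3 + n ^ 3       ≡⟨ +-assoc (twiceEdges * twiceEdges) (n ^ 3) (n ^ 3) ⟩
    twiceEdges * twiceEdges + (n ^ 3 + n ^ 3)     ∎
    where
    open ≤-Reasoning
    square edgePair δ₁₄ δ₂₃ : Quad n → ℕ
    square (i , j , k , l) = A i j * A k l * A i k * A j l
    edgePair (i , j , k , l) = A i j * A k l
    δ₁₄ (i , j , k , l) = ⟦ same l i ⟧
    δ₂₃ (i , j , k , l) = ⟦ same k j ⟧

  degree-sym : ∀ j → degree j ≡ ∑[ l < n ] A j l
  degree-sym j = ∑-cong λ l → cong ⟦_⟧ (symm G l j)

  ∑-degree² : ∑[ j < n ] (degree j * degree j) ≡ ∑[ i < n ] ∑[ l < n ] codegree i l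
  ∑-degree² = begin
    ∑[ j < n ] (degree j * degree j)                       ≡⟨ ∑-cong (λ j → cong (degree j *_) (degree-sym j)) ⟩
    ∑[ j < n ] (degree j * ∑[ l < n ] A j l)               ≡⟨ ∑-cong (λ j → ∑∑-separable (λ i → A i j) (A j)) ⟨
    ∑[ j < n ] ∑[ i < n ] ∑[ l < n ] (A i j * A j l)       ≡⟨ ∑-comm (λ j i → ∑[ l < n ] (A i j * A j l)) ⟩
    ∑[ i < n ] ∑[ j < n ] ∑[ l < n ] (A i j * A j l)       ≡⟨ ∑-cong (λ i → ∑-comm (λ j l → A i j * A j l)) ⟩
    ∑[ i < n ] ∑[ l < n ] codegree i l                     ∎
    where open ≡-Reasoning

  twiceEdges⁴≤ : twiceEdges * twiceEdges * (twiceEdges * twiceEdges) ≤ n ^ 4 * closedWalks₄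
  twiceEdges⁴≤ = begin
    E * E * (E * E)            ≤⟨ *-mono-≤ E²≤nD E²≤nD ⟩
    n * D * (n * D)            ≡⟨ regroup n D ⟩
    n * n * (D * D)            ≤⟨ *-monoʳ-≤ (n * n) D²≤n²H ⟩
    n * n * (n * (n * H))      ≡⟨ regroup′ n H ⟩
    n ^ 4 * H                  ∎
    where
    open ≤-Reasoning
    E D H : ℕ
    E = twiceEdges
    D = ∑[ j < n ] (degree j * degree j)
    H = closedWalks₄
    E²≤nD : E * E ≤ n * D
    E²≤nD = subst (λ x → x * x ≤ n * D) (sym (∑-comm A)) (Cauchy-Schwarz n degree)
    D²≤n²H : D * D ≤ n * (n * H)
    D²≤n²H rewrite ∑-degree² = Cauchy-Schwarz₂ n n codegree
    regroup : ∀ n D → n * D * (n * D) ≡ n * n * (D * D)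
    regroup = solve-∀
    regroup′ : ∀ n H → n * n * (n * (n * H)) ≡ n * (n * (n * (n * 1))) * H
    regroup′ = solve-∀

  upperBound : ∀ {L} → EdgeList G L → 32 * length L ≤ n ^ 4 + 8 * n ^ 3
  upperBound {L} edges = begin
    32 * length L                      ≡⟨ *-assoc 4 8 (length L) ⟩
    4 * (8 * length L)                 ≤⟨ *-monoʳ-≤ 4 (eightfold edges) ⟩
    4 * ∑₄ (⟦_⟧ ∘ candidate)           ≤⟨ quadratic-bound (n ^ 4) _ closedWalks₄ (twiceEdges * twiceEdges) _
                                            candidates+closedWalks≤ twiceEdges⁴≤ ⟩
    n ^ 4 + 4 * (n ^ 3 + n ^ 3)        ≡⟨ cong (n ^ 4 +_) (double (n ^ 3)) ⟩
    n ^ 4 + 8 * n ^ 3                  ∎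
    where
    open ≤-Reasoning
    double : ∀ x → 4 * (x + x) ≡ 8 * x
    double = solve-∀

upperBound-asymptotic : ∀ k {n ℓ} → suc k ≤ n → 32 * ℓ ≤ n ^ 4 + 8 * n ^ 3 →
                        32 * suc k * ℓ ≤ (suc k + 32) * n ^ 4
upperBound-asymptotic k {n} {ℓ} k<n 32ℓ≤ = begin
  32 * suc k * ℓ                        ≡⟨ regroup (suc k) ℓ ⟩
  suc k * (32 * ℓ)                      ≤⟨ *-monoʳ-≤ (suc k) 32ℓ≤ ⟩
  suc k * (n ^ 4 + 8 * n ^ 3)           ≡⟨ *-distribˡ-+ (suc k) (n ^ 4) (8 * n ^ 3) ⟩
  suc k * n ^ 4 + suc k * (8 * n ^ 3)   ≤⟨ +-monoʳ-≤ (suc k * n ^ 4) (*-mono-≤ k<n (*-monoˡ-≤ (n ^ 3) (m≤m+n 8 24))) ⟩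
  suc k * n ^ 4 + n * (32 * n ^ 3)      ≡⟨ collect (suc k) n ⟩
  (suc k + 32) * n ^ 4                  ∎
  where
  open ≤-Reasoning
  regroup : ∀ K ℓ → 32 * K * ℓ ≡ K * (32 * ℓ)
  regroup = solve-∀
  collect : ∀ K n → K * (n * (n * (n * (n * 1)))) + n * (32 * (n * (n * (n * 1))))
                  ≡ (K + 32) * (n * (n * (n * (n * 1))))
  collect = solve-∀

-- Edges of P(G) certified by vertex weights

ℕ→ℚ : ℕ → ℚ.ℚ
ℕ→ℚ m = fromℤ (ℤ.+ m)

ℕ→ℚ-+ : ∀ m n → ℕ→ℚ m ℚ.+ ℕ→ℚ n ≡ ℕ→ℚ (m + n)
ℕ→ℚ-+ m n = trans (ℚₚ./-cong (cong₂ ℤ._+_ (ℤₚ.*-identityʳ (ℤ.+ m)) (ℤₚ.*-identityʳ (ℤ.+ n))) refl)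
  (ℚₚ.↥p/↧p≡p (ℕ→ℚ (m + n)))

ℕ→ℚ-mono-< : ∀ {m n} → m < n → ℕ→ℚ m ℚ.< ℕ→ℚ n
ℕ→ℚ-mono-< {m} {n} m<n =
  ℚ.*<* (subst₂ ℤ._<_ (sym (ℤₚ.*-identityʳ (ℤ.+ m))) (sym (ℤₚ.*-identityʳ (ℤ.+ n))) (+<+ m<n))

module _ {n : ℕ} (G : Graph n) where

  polyEdge-byWeights : ∀ {i j k l} (w : Fin n → ℕ) → IsGEdge G i j → IsGEdge G k l → LexLt (i , j) (k , l) →
    w i + w j ≡ w k + w l →
    (∀ a b → IsGEdge G a b → (a , b) ≢ (i , j) → (a , b) ≢ (k , l) → w a + w b < w i + w j) →
    IsPolyEdge G (i , j , k , l)
  polyEdge-byWeights {i} {j} {k} {l} w ij kl ij<kl tie maximal = ij , kl , ij<kl , ℕ→ℚ ∘ w ,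
    trans (ℕ→ℚ-+ (w i) (w j)) (trans (cong ℕ→ℚ tie) (sym (ℕ→ℚ-+ (w k) (w l)))) ,
    λ a b ab ≢ij ≢kl → subst₂ ℚ._<_ (sym (ℕ→ℚ-+ (w a) (w b))) (sym (ℕ→ℚ-+ (w i) (w j)))
                        (ℕ→ℚ-mono-< (maximal a b ab ≢ij ≢kl))

module _ {n : ℕ} (i j k l : Fin n) (α β γ δ : ℕ) where

  weight₄ : Fin n → ℕ
  weight₄ x = if same x i then α else if same x j then β else if same x k then γ else if same x l then δ else 0

  data Weight₄ (x : Fin n) : ℕ → Set where
    at-i : x ≡ i → Weight₄ x α
    at-j : x ≡ j → Weight₄ x β
    at-k : x ≡ k → Weight₄ x γ
    at-l : x ≡ l → Weight₄ x δ
    elsewhere : Weight₄ x 0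

  weight₄-view : ∀ x → Weight₄ x (weight₄ x)
  weight₄-view x with x Fin.≟ i
  ... | yes x≡i = at-i x≡i
  ... | no _ with x Fin.≟ j
  ... | yes x≡j = at-j x≡j
  ... | no _ with x Fin.≟ k
  ... | yes x≡k = at-k x≡k
  ... | no _ with x Fin.≟ l
  ... | yes x≡l = at-l x≡l
  ... | no _ = elsewhere

module _ {n : ℕ} (G : Graph n) {i j k l : Fin n} (α β γ δ : ℕ) where

  disjointEdges-polyEdge :
    IsGEdge G i j → IsGEdge G k l → i <ᶠ k → i ≢ l → j ≢ k → j ≢ l →
    α + β ≡ γ + δ → 0 < α → 0 < β → 0 < γ → 0 < δ →
    (adj G i k ≡ true → α + γ < α + β) → (adj G i l ≡ true → α + δ < α + β) →
    (adj G j k ≡ true → β + γ < α + β) → (adj G j l ≡ true → β + δ < α + β) →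
    IsPolyEdge G (i , j , k , l)
  disjointEdges-polyEdge ij@(i<j , _) kl@(k<l , _) i<k i≢l j≢k j≢l tie α>0 β>0 γ>0 δ>0 ik il jk jl =
    polyEdge-byWeights G w ij kl (inj₁ i<k) (subst₂ _≡_ (sym wij) (sym wkl) tie)
      (λ a b ab ≢ij ≢kl → subst (w a + w b <_) (sym wij) (bound a b ab ≢ij ≢kl))
    where
    M : ℕ
    M = α + β
    w : Fin n → ℕ
    w = weight₄ i j k l α β γ δ
    i≢k : i ≢ k
    i≢k = Finₚ.<⇒≢ i<k
    wij : w i + w j ≡ M
    wij rewrite same-refl i | same-≢ (≢-sym (Finₚ.<⇒≢ i<j)) | same-refl j = refl
    wkl : w k + w l ≡ γ + δ
    wkl rewrite same-≢ (≢-sym i≢k) | same-≢ (≢-sym j≢k) | same-refl k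
              | same-≢ (≢-sym i≢l) | same-≢ (≢-sym j≢l) | same-≢ (≢-sym (Finₚ.<⇒≢ k<l)) | same-refl l = refl
    weight<M : ∀ {x v} → Weight₄ i j k l α β γ δ x v → v < M
    weight<M (at-i _) = m<m+n α β>0
    weight<M (at-j _) = m<n+m β α>0
    weight<M (at-k _) = subst (γ <_) (sym tie) (m<m+n γ δ>0)
    weight<M (at-l _) = subst (δ <_) (sym tie) (m<n+m δ γ>0)
    weight<M elsewhere = +-mono-≤ α>0 z≤n
    reversed : ∀ {x y u v} → (adj G x y ≡ true → u + v < M) → adj G y x ≡ true → v + u < M
    reversed {x} {y} {u} {v} xy yx = subst (_< M) (+-comm u v) (xy (trans (symm G x y) yx))
    bound : ∀ a b → IsGEdge G a b → (a , b) ≢ (i , j) → (a , b) ≢ (k , l) → w a + w b < M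
    bound a b (a<b , ab) ≢ij ≢kl with w a | weight₄-view i j k l α β γ δ a | w b | weight₄-view i j k l α β γ δ b
    ... | _ | elsewhere | _ | vb = weight<M vb
    ... | _ | va | _ | elsewhere = subst (_< M) (sym (+-identityʳ _)) (weight<M va)
    ... | _ | at-i refl | _ | at-i refl = ⊥-elim (Finₚ.<-irrefl refl a<b)
    ... | _ | at-j refl | _ | at-j refl = ⊥-elim (Finₚ.<-irrefl refl a<b)
    ... | _ | at-k refl | _ | at-k refl = ⊥-elim (Finₚ.<-irrefl refl a<b)
    ... | _ | at-l refl | _ | at-l refl = ⊥-elim (Finₚ.<-irrefl refl a<b)
    ... | _ | at-i refl | _ | at-j refl = ⊥-elim (≢ij refl)
    ... | _ | at-j refl | _ | at-i refl = ⊥-elim (Finₚ.<-asym a<b i<j)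
    ... | _ | at-k refl | _ | at-l refl = ⊥-elim (≢kl refl)
    ... | _ | at-l refl | _ | at-k refl = ⊥-elim (Finₚ.<-asym a<b k<l)
    ... | _ | at-i refl | _ | at-k refl = ik ab
    ... | _ | at-k refl | _ | at-i refl = reversed {i} {k} {α} {γ} ik ab
    ... | _ | at-i refl | _ | at-l refl = il ab
    ... | _ | at-l refl | _ | at-i refl = reversed {i} {l} {α} {δ} il ab
    ... | _ | at-j refl | _ | at-k refl = jk ab
    ... | _ | at-k refl | _ | at-j refl = reversed {j} {k} {β} {γ} jk ab
    ... | _ | at-j refl | _ | at-l refl = jl ab
    ... | _ | at-l refl | _ | at-j refl = reversed {j} {l} {β} {δ} jl ab

SamePair : ∀ {n} → Fin n × Fin n → Fin n × Fin n → Set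
SamePair (a , b) (x , y) = (a ≡ x × b ≡ y) ⊎ (a ≡ y × b ≡ x)

samePair-sorted : ∀ {n} {a b i j x y : Fin n} → a <ᶠ b → i <ᶠ j →
                  SamePair (a , b) (x , y) → SamePair (i , j) (x , y) → (a , b) ≡ (i , j)
samePair-sorted _ _ (inj₁ (refl , refl)) (inj₁ (refl , refl)) = refl
samePair-sorted a<b i<j (inj₁ (refl , refl)) (inj₂ (refl , refl)) = ⊥-elim (Finₚ.<-asym a<b i<j)
samePair-sorted a<b i<j (inj₂ (refl , refl)) (inj₁ (refl , refl)) = ⊥-elim (Finₚ.<-asym a<b i<j)
samePair-sorted _ _ (inj₂ (refl , refl)) (inj₂ (refl , refl)) = refl

module _ {n : ℕ} (z u v : Fin n) where

  weight₃ : Fin n → ℕ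
  weight₃ x = if same x z then 2 else if same x u then 1 else if same x v then 1 else 0

  data Weight₃ (x : Fin n) : ℕ → Set where
    at-z : x ≡ z → Weight₃ x 2
    at-u : x ≡ u → Weight₃ x 1
    at-v : x ≡ v → Weight₃ x 1
    elsewhere : Weight₃ x 0

  weight₃-view : ∀ x → Weight₃ x (weight₃ x)
  weight₃-view x with x Fin.≟ z
  ... | yes x≡z = at-z x≡z
  ... | no _ with x Fin.≟ u
  ... | yes x≡u = at-u x≡u
  ... | no _ with x Fin.≟ v
  ... | yes x≡v = at-v x≡v
  ... | no _ = elsewhere

module _ {n : ℕ} (G : Graph n) {i j k l : Fin n} where

  sharedVertex-polyEdge : IsGEdge G i j → IsGEdge G k l → LexLt (i , j) (k , l) →
    ∀ z {u v} → u ≢ v → SamePair (i , j) (z , u) → SamePair (k , l) (z , v) → IsPolyEdge G (i , j , k , l)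
  sharedVertex-polyEdge ij@(i<j , _) kl@(k<l , _) ij<kl z {u} {v} u≢v ij~zu kl~zv =
    polyEdge-byWeights G w ij kl ij<kl (trans (pair-weight ij~zu wu) (sym (pair-weight kl~zv wv)))
      (λ a b ab ≢ij ≢kl → subst (w a + w b <_) (sym (pair-weight ij~zu wu)) (bound a b ab ≢ij ≢kl))
    where
    w : Fin n → ℕ
    w = weight₃ z u v
    endpoints-differ : ∀ {a b x y} → a <ᶠ b → SamePair (a , b) (x , y) → y ≢ x
    endpoints-differ a<b (inj₁ (refl , refl)) refl = Finₚ.<-irrefl refl a<b
    endpoints-differ a<b (inj₂ (refl , refl)) refl = Finₚ.<-irrefl refl a<b
    u≢z : u ≢ z
    u≢z = endpoints-differ i<j ij~zu
    v≢z : v ≢ z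
    v≢z = endpoints-differ k<l kl~zv
    wz : w z ≡ 2
    wz rewrite same-refl z = refl
    wu : w u ≡ 1
    wu rewrite same-≢ u≢z | same-refl u = refl
    wv : w v ≡ 1
    wv rewrite same-≢ v≢z | same-≢ (≢-sym u≢v) | same-refl v = refl
    pair-weight : ∀ {a b y} → SamePair (a , b) (z , y) → w y ≡ 1 → w a + w b ≡ 3
    pair-weight (inj₁ (refl , refl)) wy = cong₂ _+_ wz wy
    pair-weight (inj₂ (refl , refl)) wy = cong₂ _+_ wy wz
    weight≤2 : ∀ {x m} → Weight₃ z u v x m → m < 3
    weight≤2 (at-z _) = ≤-refl
    weight≤2 (at-u _) = s≤s (s≤s z≤n)
    weight≤2 (at-v _) = s≤s (s≤s z≤n)
    weight≤2 elsewhere = s≤s z≤n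
    bound : ∀ a b → IsGEdge G a b → (a , b) ≢ (i , j) → (a , b) ≢ (k , l) → w a + w b < 3
    bound a b (a<b , _) ≢ij ≢kl with w a | weight₃-view z u v a | w b | weight₃-view z u v b
    ... | _ | elsewhere | _ | vb = weight≤2 vb
    ... | _ | va | _ | elsewhere = subst (_< 3) (sym (+-identityʳ _)) (weight≤2 va)
    ... | _ | at-z refl | _ | at-z refl = ⊥-elim (Finₚ.<-irrefl refl a<b)
    ... | _ | at-u refl | _ | at-u refl = ⊥-elim (Finₚ.<-irrefl refl a<b)
    ... | _ | at-v refl | _ | at-v refl = ⊥-elim (Finₚ.<-irrefl refl a<b)
    ... | _ | at-z refl | _ | at-u refl = ⊥-elim (≢ij (samePair-sorted a<b i<j (inj₁ (refl , refl)) ij~zu))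
    ... | _ | at-u refl | _ | at-z refl = ⊥-elim (≢ij (samePair-sorted a<b i<j (inj₂ (refl , refl)) ij~zu))
    ... | _ | at-z refl | _ | at-v refl = ⊥-elim (≢kl (samePair-sorted a<b k<l (inj₁ (refl , refl)) kl~zv))
    ... | _ | at-v refl | _ | at-z refl = ⊥-elim (≢kl (samePair-sorted a<b k<l (inj₂ (refl , refl)) kl~zv))
    ... | _ | at-u refl | _ | at-v refl = ≤-refl
    ... | _ | at-v refl | _ | at-u refl = ≤-refl

-- The lower-bound construction

Within : ℕ → ℕ → ℕ → Set
Within a b x = a ≤ x × x < b

within? : ∀ a b x → Dec (Within a b x)
within? a b x = a ≤? x ×-dec x <? b

-- The conjuncts are ordered so that the indicator of a chain reduces along suc, as ∑∑-chain needs.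
Chain : ℕ → ℕ → ℕ → ℕ → Set
Chain a b x y = x < y × a ≤ x × y < b

chain? : ∀ a b x y → Dec (Chain a b x y)
chain? a b x y = x <? y ×-dec a ≤? x ×-dec y <? b

pairs : ℕ → ℕ
pairs zero = 0
pairs (suc m) = m + pairs m

pairs-double : ∀ m → 2 * pairs (suc m) ≡ suc m * m
pairs-double zero = refl
pairs-double (suc m) = trans (*-distribˡ-+ 2 (suc m) (pairs (suc m))) (trans (cong (2 * suc m +_) (pairs-double m)) (step m))
  where step : ∀ m → 2 * suc m + suc m * m ≡ suc (suc m) * suc m
        step = solve-∀

≤ᵇ-suc : ∀ a x → (suc a ≤ᵇ suc x) ≡ (a ≤ᵇ x)
≤ᵇ-suc zero x = refl
≤ᵇ-suc (suc a) x = refl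

∑-within : ∀ a m {n} → a + m ≤ n → ∑[ x < n ] ⟦ does (within? a (a + m) (toℕ x)) ⟧ ≡ m
∑-within zero zero {n} _ = ∑-zero n
∑-within zero (suc m) {suc n} (s≤s m≤n) = cong suc (∑-within zero m m≤n)
∑-within (suc a) m {suc n} (s≤s a+m≤n) =
  trans (∑-cong {n} λ x → cong (λ t → ⟦ t ∧ (toℕ x <ᵇ a + m) ⟧) (≤ᵇ-suc a (toℕ x))) (∑-within a m a+m≤n)

∑∑-chain : ∀ a m {n} → a + m ≤ n → ∑[ x < n ] ∑[ y < n ] ⟦ does (chain? a (a + m) (toℕ x) (toℕ y)) ⟧ ≡ pairs m
∑∑-chain zero zero {n} _ =
  trans (∑-cong {n} λ x → trans (∑-cong {n} λ y → cong ⟦_⟧ (Boolₚ.∧-zeroʳ (toℕ x <ᵇ toℕ y))) (∑-zero n)) (∑-zero n)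
∑∑-chain zero (suc m) {suc n} (s≤s m≤n) = cong₂ _+_ (∑-within zero m m≤n) (∑∑-chain zero m m≤n)
∑∑-chain (suc a) m {suc n} (s≤s a+m≤n) = cong₂ _+_ (∑-zero n)
  (trans (∑-cong {n} λ x → ∑-cong {n} λ y →
           cong (λ t → ⟦ (toℕ x <ᵇ toℕ y) ∧ t ∧ (toℕ y <ᵇ a + m) ⟧) (≤ᵇ-suc a (toℕ x)))
         (∑∑-chain a m a+m≤n))

exhibitedEdges : ℕ → ℕ → ℕ → ℕ
exhibitedEdges p q r = pairs p * pairs q + (pairs p * (q * r) + (p * r * pairs q + (pairs (p + q) * r + (p + q) * pairs r)))

data Part : Set where
  clique₁ clique₂ hub : Part

linked : Part → Part → Bool
linked clique₁ clique₁ = true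
linked clique₂ clique₂ = true
linked clique₁ clique₂ = false
linked clique₂ clique₁ = false
linked hub hub = false
linked _ _ = true

linked-comm : ∀ s t → linked s t ≡ linked t s
linked-comm clique₁ clique₁ = refl
linked-comm clique₁ clique₂ = refl
linked-comm clique₁ hub = refl
linked-comm clique₂ clique₁ = refl
linked-comm clique₂ clique₂ = refl
linked-comm clique₂ hub = refl
linked-comm hub clique₁ = refl
linked-comm hub clique₂ = refl
linked-comm hub hub = refl

module Construction (p q r : ℕ) (p>0 : 0 < p) (r>0 : 0 < r) where

  n : ℕ
  n = p + q + r

  part : Fin n → Part
  part x = if does (toℕ x <? p) then clique₁ else if does (toℕ x <? p + q) then clique₂ else hub

  part-clique₁ : ∀ {x} → toℕ x < p → part x ≡ clique₁
  part-clique₁ {x} x<p rewrite dec-true (toℕ x <? p) x<p = refl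

  part-clique₂ : ∀ {x} → p ≤ toℕ x → toℕ x < p + q → part x ≡ clique₂
  part-clique₂ {x} p≤x x<p+q rewrite dec-false (toℕ x <? p) (≤⇒≯ p≤x) | dec-true (toℕ x <? p + q) x<p+q = refl

  part-hub : ∀ {x} → p + q ≤ toℕ x → part x ≡ hub
  part-hub {x} p+q≤x
    rewrite dec-false (toℕ x <? p) (≤⇒≯ (≤-trans (m≤m+n p q) p+q≤x))
          | dec-false (toℕ x <? p + q) (≤⇒≯ p+q≤x) = refl

  linked-hub : ∀ {x} → toℕ x < p + q → linked (part x) hub ≡ true
  linked-hub {x} x<p+q with toℕ x <? p
  ... | yes x<p rewrite part-clique₁ x<p = refl
  ... | no x≮p rewrite part-clique₂ (≮⇒≥ x≮p) x<p+q = refl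

  adjacency : Fin n → Fin n → Bool
  adjacency x y = not (same x y) ∧ linked (part x) (part y)

  adjacent : ∀ {x y} → x ≢ y → linked (part x) (part y) ≡ true → adjacency x y ≡ true
  adjacent x≢y linked≡true rewrite same-≢ x≢y = linked≡true

  firstVertex hubVertex : Fin n
  firstVertex = Fin.fromℕ< (≤-trans p>0 (≤-trans (m≤m+n p q) (m≤m+n (p + q) r)))
  hubVertex = Fin.fromℕ< (m<m+n (p + q) r>0)

  neighbour : ∀ x → ∃ λ y → adjacency x y ≡ true
  neighbour x with toℕ x <? p + q
  ... | yes x<p+q = hubVertex , adjacent x≢hub
    (subst (λ s → linked (part x) s ≡ true) (sym (part-hub (≤-reflexive (sym (Finₚ.toℕ-fromℕ< _))))) (linked-hub x<p+q))
    where
    x≢hub : x ≢ hubVertex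
    x≢hub refl = <-irrefl (Finₚ.toℕ-fromℕ< _) x<p+q
  ... | no x≮p+q = firstVertex , adjacent x≢first (subst₂ (λ s t → linked s t ≡ true)
    (sym (part-hub (≮⇒≥ x≮p+q))) (sym (part-clique₁ (subst (_< p) (sym (Finₚ.toℕ-fromℕ< _)) p>0))) refl)
    where
    x≢first : x ≢ firstVertex
    x≢first refl = x≮p+q (subst (_< p + q) (sym (Finₚ.toℕ-fromℕ< _)) (≤-trans p>0 (m≤m+n p q)))

  graph : Graph n
  graph = record
    { adj = adjacency
    ; symm = λ x y → cong₂ (λ s t → not s ∧ t) (same-comm x y) (linked-comm (part x) (part y))
    ; irrefl = λ x → cong (λ s → not s ∧ linked (part x) (part x)) (same-refl x)
    ; noIsol = neighbour
    }

  edgeBetween : ∀ {x y s t} → toℕ x < toℕ y → part x ≡ s → part y ≡ t → linked s t ≡ true → IsGEdge graph x y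
  edgeBetween x<y refl refl st = x<y , adjacent (Finₚ.<⇒≢ x<y) st

  noEdgeBetween : ∀ {x y s t} {P : Set} → part x ≡ s → part y ≡ t → linked s t ≡ false → adjacency x y ≡ true → P
  noEdgeBetween {x} {y} refl refl st xy =
    case trans (sym xy) (trans (cong (not (same x y) ∧_) st) (Boolₚ.∧-zeroʳ _)) of λ ()

  Family₁ Family₂ Family₃ Family₄ Family₅ : Quad n → Set
  Family₁ (i , j , k , l) = Chain 0 p (toℕ i) (toℕ j) × Chain p (p + q) (toℕ k) (toℕ l)
  Family₂ (i , j , k , l) = Chain 0 p (toℕ i) (toℕ j) × Within p (p + q) (toℕ k) × Within (p + q) n (toℕ l)
  Family₃ (i , j , k , l) = (Within 0 p (toℕ i) × Within (p + q) n (toℕ j)) × Chain p (p + q) (toℕ k) (toℕ l)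
  Family₄ (i , j , k , l) = Chain 0 (p + q) (toℕ i) (toℕ k) × Within (p + q) n (toℕ j) × l ≡ j
  Family₅ (i , j , k , l) = (Within 0 (p + q) (toℕ i) × k ≡ i) × Chain (p + q) n (toℕ j) (toℕ l)

  family₁-polyEdge : ∀ {i j k l} → Family₁ (i , j , k , l) → IsPolyEdge graph (i , j , k , l)
  family₁-polyEdge {i} {j} {k} {l} ((i<j , _ , j<p) , (k<l , p≤k , l<p+q)) =
    disjointEdges-polyEdge graph 1 1 1 1 (edgeBetween i<j i∈₁ j∈₁ refl) (edgeBetween k<l k∈₂ l∈₂ refl)
      (<-≤-trans i<p p≤k)
      (Finₚ.<⇒≢ (<-≤-trans i<p p≤l)) (Finₚ.<⇒≢ (<-≤-trans j<p p≤k)) (Finₚ.<⇒≢ (<-≤-trans j<p p≤l))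
      refl z<s z<s z<s z<s
      (noEdgeBetween i∈₁ k∈₂ refl) (noEdgeBetween i∈₁ l∈₂ refl)
      (noEdgeBetween j∈₁ k∈₂ refl) (noEdgeBetween j∈₁ l∈₂ refl)
    where
    i<p : toℕ i < p
    i<p = <-trans i<j j<p
    p≤l : p ≤ toℕ l
    p≤l = ≤-trans p≤k (<⇒≤ k<l)
    i∈₁ : part i ≡ clique₁
    i∈₁ = part-clique₁ i<p
    j∈₁ : part j ≡ clique₁
    j∈₁ = part-clique₁ j<p
    k∈₂ : part k ≡ clique₂
    k∈₂ = part-clique₂ p≤k (<-trans k<l l<p+q)
    l∈₂ : part l ≡ clique₂
    l∈₂ = part-clique₂ p≤l l<p+q

  family₂-polyEdge : ∀ {i j k l} → Family₂ (i , j , k , l) → IsPolyEdge graph (i , j , k , l)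
  family₂-polyEdge {i} {j} {k} {l} ((i<j , _ , j<p) , (p≤k , k<p+q) , (p+q≤l , _)) =
    disjointEdges-polyEdge graph 2 2 3 1 (edgeBetween i<j i∈₁ j∈₁ refl) (edgeBetween k<l k∈₂ l∈hub refl)
      (<-≤-trans i<p p≤k)
      (Finₚ.<⇒≢ (<-≤-trans i<p p≤l)) (Finₚ.<⇒≢ (<-≤-trans j<p p≤k)) (Finₚ.<⇒≢ (<-≤-trans j<p p≤l))
      refl z<s z<s z<s z<s
      (noEdgeBetween i∈₁ k∈₂ refl) (λ _ → ≤-refl) (noEdgeBetween j∈₁ k∈₂ refl) (λ _ → ≤-refl)
    where
    i<p : toℕ i < p
    i<p = <-trans i<j j<p
    p≤l : p ≤ toℕ l
    p≤l = ≤-trans (m≤m+n p q) p+q≤l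
    k<l : toℕ k < toℕ l
    k<l = <-≤-trans k<p+q p+q≤l
    i∈₁ : part i ≡ clique₁
    i∈₁ = part-clique₁ i<p
    j∈₁ : part j ≡ clique₁
    j∈₁ = part-clique₁ j<p
    k∈₂ : part k ≡ clique₂
    k∈₂ = part-clique₂ p≤k k<p+q
    l∈hub : part l ≡ hub
    l∈hub = part-hub p+q≤l

  family₃-polyEdge : ∀ {i j k l} → Family₃ (i , j , k , l) → IsPolyEdge graph (i , j , k , l)
  family₃-polyEdge {i} {j} {k} {l} (((_ , i<p) , (p+q≤j , _)) , (k<l , p≤k , l<p+q)) =
    disjointEdges-polyEdge graph 3 1 2 2 (edgeBetween i<j i∈₁ j∈hub refl) (edgeBetween k<l k∈₂ l∈₂ refl)
      (<-≤-trans i<p p≤k) (Finₚ.<⇒≢ (<-≤-trans i<p p≤l)) (≢-sym (Finₚ.<⇒≢ (<-≤-trans k<p+q p+q≤j)))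
      (≢-sym (Finₚ.<⇒≢ (<-≤-trans l<p+q p+q≤j)))
      refl z<s z<s z<s z<s
      (noEdgeBetween i∈₁ k∈₂ refl) (noEdgeBetween i∈₁ l∈₂ refl) (λ _ → ≤-refl) (λ _ → ≤-refl)
    where
    p≤l : p ≤ toℕ l
    p≤l = ≤-trans p≤k (<⇒≤ k<l)
    k<p+q : toℕ k < p + q
    k<p+q = <-trans k<l l<p+q
    i<j : toℕ i < toℕ j
    i<j = <-≤-trans i<p (≤-trans (m≤m+n p q) p+q≤j)
    i∈₁ : part i ≡ clique₁
    i∈₁ = part-clique₁ i<p
    j∈hub : part j ≡ hub
    j∈hub = part-hub p+q≤j
    k∈₂ : part k ≡ clique₂
    k∈₂ = part-clique₂ p≤k k<p+q
    l∈₂ : part l ≡ clique₂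
    l∈₂ = part-clique₂ p≤l l<p+q

  family₄-polyEdge : ∀ {i j k l} → Family₄ (i , j , k , l) → IsPolyEdge graph (i , j , k , l)
  family₄-polyEdge {i} {j} {k} ((i<k , _ , k<p+q) , (p+q≤j , _) , refl) =
    sharedVertex-polyEdge graph (toHub (<-trans i<k k<p+q)) (toHub k<p+q) (inj₁ i<k) j (Finₚ.<⇒≢ i<k)
      (inj₂ (refl , refl)) (inj₂ (refl , refl))
    where
    toHub : ∀ {x} → toℕ x < p + q → IsGEdge graph x j
    toHub x<p+q = edgeBetween (<-≤-trans x<p+q p+q≤j) refl (part-hub p+q≤j) (linked-hub x<p+q)

  family₅-polyEdge : ∀ {i j k l} → Family₅ (i , j , k , l) → IsPolyEdge graph (i , j , k , l)
  family₅-polyEdge {i} {j} {_} {l} (((_ , i<p+q) , refl) , (j<l , p+q≤j , _)) =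
    sharedVertex-polyEdge graph (fromCliques p+q≤j) (fromCliques (≤-trans p+q≤j (<⇒≤ j<l))) (inj₂ (refl , j<l)) i
      (Finₚ.<⇒≢ j<l) (inj₁ (refl , refl)) (inj₁ (refl , refl))
    where
    fromCliques : ∀ {y} → p + q ≤ toℕ y → IsGEdge graph i y
    fromCliques p+q≤y = edgeBetween (<-≤-trans i<p+q p+q≤y) refl (part-hub p+q≤y) (linked-hub i<p+q)

  Family : Quad n → Set
  Family q = Family₁ q ⊎ Family₂ q ⊎ Family₃ q ⊎ Family₄ q ⊎ Family₅ q

  family⇒polyEdge : ∀ q → Family q → IsPolyEdge graph q
  family⇒polyEdge _ (inj₁ f) = family₁-polyEdge f
  family⇒polyEdge _ (inj₂ (inj₁ f)) = family₂-polyEdge f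
  family⇒polyEdge _ (inj₂ (inj₂ (inj₁ f))) = family₃-polyEdge f
  family⇒polyEdge _ (inj₂ (inj₂ (inj₂ (inj₁ f)))) = family₄-polyEdge f
  family⇒polyEdge _ (inj₂ (inj₂ (inj₂ (inj₂ f)))) = family₅-polyEdge f

  <p⇒≱p+q : ∀ {x} → x < p → ¬ (p + q ≤ x)
  <p⇒≱p+q x<p = <⇒≱ (<-≤-trans x<p (m≤m+n p q))

  family₁-exclusive : ∀ {q} → Family₁ q → ¬ (Family₂ q ⊎ Family₃ q ⊎ Family₄ q ⊎ Family₅ q)
  family₁-exclusive ((_ , _ , j<p) , (_ , _ , l<p+q)) (inj₁ (_ , _ , p+q≤l , _)) = <⇒≱ l<p+q p+q≤l
  family₁-exclusive ((_ , _ , j<p) , _) (inj₂ (inj₁ ((_ , p+q≤j , _) , _))) = <p⇒≱p+q j<p p+q≤j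
  family₁-exclusive ((_ , _ , j<p) , _) (inj₂ (inj₂ (inj₁ (_ , (p+q≤j , _) , _)))) = <p⇒≱p+q j<p p+q≤j
  family₁-exclusive ((_ , _ , j<p) , _) (inj₂ (inj₂ (inj₂ (_ , _ , p+q≤j , _)))) = <p⇒≱p+q j<p p+q≤j

  family₂-exclusive : ∀ {q} → Family₂ q → ¬ (Family₃ q ⊎ Family₄ q ⊎ Family₅ q)
  family₂-exclusive ((_ , _ , j<p) , _) (inj₁ ((_ , p+q≤j , _) , _)) = <p⇒≱p+q j<p p+q≤j
  family₂-exclusive ((_ , _ , j<p) , _) (inj₂ (inj₁ (_ , (p+q≤j , _) , _))) = <p⇒≱p+q j<p p+q≤j
  family₂-exclusive ((_ , _ , j<p) , _) (inj₂ (inj₂ (_ , _ , p+q≤j , _))) = <p⇒≱p+q j<p p+q≤j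

  family₃-exclusive : ∀ {q} → Family₃ q → ¬ (Family₄ q ⊎ Family₅ q)
  family₃-exclusive (_ , (_ , _ , l<p+q)) (inj₁ (_ , (p+q≤j , _) , refl)) = <⇒≱ l<p+q p+q≤j
  family₃-exclusive (_ , (_ , _ , l<p+q)) (inj₂ (_ , j<l , p+q≤j , _)) = <⇒≱ l<p+q (≤-trans p+q≤j (<⇒≤ j<l))

  family₄-exclusive : ∀ {q} → Family₄ q → ¬ Family₅ q
  family₄-exclusive ((i<k , _) , _) ((_ , refl) , _) = <-irrefl refl i<k

  family₁? : ∀ q → Dec (Family₁ q)
  family₁? (i , j , k , l) = chain? 0 p (toℕ i) (toℕ j) ×-dec chain? p (p + q) (toℕ k) (toℕ l)

  family₂? : ∀ q → Dec (Family₂ q)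
  family₂? (i , j , k , l) = chain? 0 p (toℕ i) (toℕ j) ×-dec within? p (p + q) (toℕ k) ×-dec within? (p + q) n (toℕ l)

  family₃? : ∀ q → Dec (Family₃ q)
  family₃? (i , j , k , l) = (within? 0 p (toℕ i) ×-dec within? (p + q) n (toℕ j)) ×-dec chain? p (p + q) (toℕ k) (toℕ l)

  family₄? : ∀ q → Dec (Family₄ q)
  family₄? (i , j , k , l) = chain? 0 (p + q) (toℕ i) (toℕ k) ×-dec within? (p + q) n (toℕ j) ×-dec l Fin.≟ j

  family₅? : ∀ q → Dec (Family₅ q)
  family₅? (i , j , k , l) = (within? 0 (p + q) (toℕ i) ×-dec k Fin.≟ i) ×-dec chain? (p + q) n (toℕ j) (toℕ l)

  family? : ∀ q → Dec (Family q)
  family? q = family₁? q ⊎-dec family₂? q ⊎-dec family₃? q ⊎-dec family₄? q ⊎-dec family₅? q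

  p≤n : 0 + p ≤ n
  p≤n = ≤-trans (m≤m+n p q) (m≤m+n (p + q) r)

  p+q≤n : p + q ≤ n
  p+q≤n = m≤m+n (p + q) r

  χ-within : ℕ → ℕ → Fin n → ℕ
  χ-within a b x = ⟦ does (within? a b (toℕ x)) ⟧

  χ-chain : ℕ → ℕ → Fin n → Fin n → ℕ
  χ-chain a b x y = ⟦ does (chain? a b (toℕ x) (toℕ y)) ⟧

  count₁ : ∑₄ (λ x → ⟦ does (family₁? x) ⟧) ≡ pairs p * pairs q
  count₁ = begin
    ∑₄ (λ x → ⟦ does (family₁? x) ⟧)
      ≡⟨ ∑₄-cong {n} (λ (i , j , k , l) → ⟦∧⟧ (does (chain? 0 p (toℕ i) (toℕ j))) (does (chain? p (p + q) (toℕ k) (toℕ l)))) ⟩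
    ∑₄ (λ (i , j , k , l) → χ-chain 0 p i j * χ-chain p (p + q) k l)
      ≡⟨ ∑₄-separable (χ-chain 0 p) (χ-chain p (p + q)) ⟩
    (∑[ i < n ] ∑[ j < n ] χ-chain 0 p i j) * (∑[ k < n ] ∑[ l < n ] χ-chain p (p + q) k l)
      ≡⟨ cong₂ _*_ (∑∑-chain 0 p p≤n) (∑∑-chain p q p+q≤n) ⟩
    pairs p * pairs q ∎
    where open ≡-Reasoning

  count₂ : ∑₄ (λ x → ⟦ does (family₂? x) ⟧) ≡ pairs p * (q * r)
  count₂ = begin
    ∑₄ (λ x → ⟦ does (family₂? x) ⟧)
      ≡⟨ ∑₄-cong {n} (λ (i , j , k , l) → trans (⟦∧⟧ (does (chain? 0 p (toℕ i) (toℕ j))) _)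
           (cong (χ-chain 0 p i j *_) (⟦∧⟧ (does (within? p (p + q) (toℕ k))) (does (within? (p + q) n (toℕ l)))))) ⟩
    ∑₄ (λ (i , j , k , l) → χ-chain 0 p i j * (χ-within p (p + q) k * χ-within (p + q) n l))
      ≡⟨ ∑₄-separable (χ-chain 0 p) (λ k l → χ-within p (p + q) k * χ-within (p + q) n l) ⟩
    (∑[ i < n ] ∑[ j < n ] χ-chain 0 p i j) * (∑[ k < n ] ∑[ l < n ] (χ-within p (p + q) k * χ-within (p + q) n l))
      ≡⟨ cong ((∑[ i < n ] ∑[ j < n ] χ-chain 0 p i j) *_) (∑∑-separable (χ-within p (p + q)) (χ-within (p + q) n)) ⟩
    (∑[ i < n ] ∑[ j < n ] χ-chain 0 p i j) * ((∑[ k < n ] χ-within p (p + q) k) * (∑[ l < n ] χ-within (p + q) n l))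
      ≡⟨ cong₂ _*_ (∑∑-chain 0 p p≤n) (cong₂ _*_ (∑-within p q p+q≤n) (∑-within (p + q) r ≤-refl)) ⟩
    pairs p * (q * r) ∎
    where open ≡-Reasoning

  count₃ : ∑₄ (λ x → ⟦ does (family₃? x) ⟧) ≡ p * r * pairs q
  count₃ = begin
    ∑₄ (λ x → ⟦ does (family₃? x) ⟧)
      ≡⟨ ∑₄-cong {n} (λ (i , j , k , l) → trans (⟦∧⟧ (does (within? 0 p (toℕ i)) ∧ does (within? (p + q) n (toℕ j))) _)
           (cong (_* χ-chain p (p + q) k l) (⟦∧⟧ (does (within? 0 p (toℕ i))) (does (within? (p + q) n (toℕ j)))))) ⟩
    ∑₄ (λ (i , j , k , l) → χ-within 0 p i * χ-within (p + q) n j * χ-chain p (p + q) k l)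
      ≡⟨ ∑₄-separable (λ i j → χ-within 0 p i * χ-within (p + q) n j) (χ-chain p (p + q)) ⟩
    (∑[ i < n ] ∑[ j < n ] (χ-within 0 p i * χ-within (p + q) n j)) * (∑[ k < n ] ∑[ l < n ] χ-chain p (p + q) k l)
      ≡⟨ cong (_* (∑[ k < n ] ∑[ l < n ] χ-chain p (p + q) k l)) (∑∑-separable (χ-within 0 p) (χ-within (p + q) n)) ⟩
    (∑[ i < n ] χ-within 0 p i) * (∑[ j < n ] χ-within (p + q) n j) * (∑[ k < n ] ∑[ l < n ] χ-chain p (p + q) k l)
      ≡⟨ cong₂ _*_ (cong₂ _*_ (∑-within 0 p p≤n) (∑-within (p + q) r ≤-refl)) (∑∑-chain p q p+q≤n) ⟩
    p * r * pairs q ∎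
    where open ≡-Reasoning

  count₄ : ∑₄ (λ x → ⟦ does (family₄? x) ⟧) ≡ pairs (p + q) * r
  count₄ = begin
    ∑₄ (λ x → ⟦ does (family₄? x) ⟧)
      ≡⟨ ∑₄-cong {n} (λ (i , j , k , l) → trans (⟦∧⟧ (does (chain? 0 (p + q) (toℕ i) (toℕ k))) _)
           (cong (χ-chain 0 (p + q) i k *_) (⟦∧⟧ (does (within? (p + q) n (toℕ j))) (same l j)))) ⟩
    ∑₄ (λ (i , j , k , l) → χ-chain 0 (p + q) i k * (χ-within (p + q) n j * ⟦ same l j ⟧))
      ≡⟨ ∑₄-shared₂₄ (χ-chain 0 (p + q)) (χ-within (p + q) n) ⟩
    (∑[ i < n ] ∑[ k < n ] χ-chain 0 (p + q) i k) * (∑[ j < n ] χ-within (p + q) n j)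
      ≡⟨ cong₂ _*_ (∑∑-chain 0 (p + q) p+q≤n) (∑-within (p + q) r ≤-refl) ⟩
    pairs (p + q) * r ∎
    where open ≡-Reasoning

  count₅ : ∑₄ (λ x → ⟦ does (family₅? x) ⟧) ≡ (p + q) * pairs r
  count₅ = begin
    ∑₄ (λ x → ⟦ does (family₅? x) ⟧)
      ≡⟨ ∑₄-cong {n} (λ (i , j , k , l) → trans (⟦∧⟧ (does (within? 0 (p + q) (toℕ i)) ∧ same k i) _)
           (cong (_* χ-chain (p + q) n j l) (⟦∧⟧ (does (within? 0 (p + q) (toℕ i))) (same k i)))) ⟩
    ∑₄ (λ (i , j , k , l) → χ-within 0 (p + q) i * ⟦ same k i ⟧ * χ-chain (p + q) n j l)
      ≡⟨ ∑₄-shared₁₃ (χ-within 0 (p + q)) (χ-chain (p + q) n) ⟩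
    (∑[ i < n ] χ-within 0 (p + q) i) * (∑[ j < n ] ∑[ l < n ] χ-chain (p + q) n j l)
      ≡⟨ cong₂ _*_ (∑-within 0 (p + q) p+q≤n) (∑∑-chain (p + q) r ≤-refl) ⟩
    (p + q) * pairs r ∎
    where open ≡-Reasoning

  familyCount : ∑₄ (λ x → ⟦ does (family? x) ⟧) ≡ exhibitedEdges p q r
  familyCount = begin
    ∑₄ (λ x → ⟦ does (family? x) ⟧)                          ≡⟨ ∑₄-cong split ⟩
    ∑₄ (λ x → c₁ x + (c₂ x + (c₃ x + (c₄ x + c₅ x))))
      ≡⟨ trans (∑₄-distrib-+ c₁ _) (cong (∑₄ c₁ +_) (trans (∑₄-distrib-+ c₂ _)
           (cong (∑₄ c₂ +_) (trans (∑₄-distrib-+ c₃ _) (cong (∑₄ c₃ +_) (∑₄-distrib-+ c₄ c₅)))))) ⟩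
    ∑₄ c₁ + (∑₄ c₂ + (∑₄ c₃ + (∑₄ c₄ + ∑₄ c₅)))               ≡⟨ cong₂ _+_ count₁ (cong₂ _+_ count₂
                                                                  (cong₂ _+_ count₃ (cong₂ _+_ count₄ count₅))) ⟩
    exhibitedEdges p q r                                      ∎
    where
    open ≡-Reasoning
    c₁ c₂ c₃ c₄ c₅ : Quad n → ℕ
    c₁ x = ⟦ does (family₁? x) ⟧
    c₂ x = ⟦ does (family₂? x) ⟧
    c₃ x = ⟦ does (family₃? x) ⟧
    c₄ x = ⟦ does (family₄? x) ⟧
    c₅ x = ⟦ does (family₅? x) ⟧
    split : ∀ x → ⟦ does (family? x) ⟧ ≡ c₁ x + (c₂ x + (c₃ x + (c₄ x + c₅ x)))
    split x =
      trans (⟦does-⊎⟧ (family₁? x) (family₂? x ⊎-dec family₃? x ⊎-dec family₄? x ⊎-dec family₅? x) family₁-exclusive)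
      (cong (c₁ x +_)
      (trans (⟦does-⊎⟧ (family₂? x) (family₃? x ⊎-dec family₄? x ⊎-dec family₅? x) family₂-exclusive)
      (cong (c₂ x +_)
      (trans (⟦does-⊎⟧ (family₃? x) (family₄? x ⊎-dec family₅? x) family₃-exclusive)
      (cong (c₃ x +_)
      (⟦does-⊎⟧ (family₄? x) (family₅? x) family₄-exclusive))))))

  edgeList : List (Quad n)
  edgeList = filterᵇ (does ∘ family?) allQuads

  edgeList-isEdgeList : EdgeList graph edgeList
  edgeList-isEdgeList = Uniqueₚ.filter⁺ (T? ∘ does ∘ family?) allQuads-unique ,
    All.map (λ {x} Tx → family⇒polyEdge x (does⇒ (family? x) (Equivalence.to Boolₚ.T-≡ Tx)))
            (Allₚ.all-filter (T? ∘ does ∘ family?) allQuads)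

  length-edgeList : length edgeList ≡ exhibitedEdges p q r
  length-edgeList = trans (length-filter-allQuads (does ∘ family?)) familyCount

-- Polynomial inequalities by coefficient comparison

infixl 6 _⊕_
infixl 7 _⊗_

data Poly : Set where
  var : Poly
  con : ℕ → Poly
  _⊕_ _⊗_ : Poly → Poly → Poly

eval : Poly → ℕ → ℕ
eval var t = t
eval (con c) t = c
eval (e ⊕ e′) t = eval e t + eval e′ t
eval (e ⊗ e′) t = eval e t * eval e′ t

horner : List ℕ → ℕ → ℕ
horner [] t = 0
horner (c ∷ cs) t = c + t * horner cs t

_+ᶜ_ : List ℕ → List ℕ → List ℕ
[] +ᶜ ds = ds
(c ∷ cs) +ᶜ [] = c ∷ cs
(c ∷ cs) +ᶜ (d ∷ ds) = c + d ∷ cs +ᶜ ds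

_·ᶜ_ : ℕ → List ℕ → List ℕ
c ·ᶜ [] = []
c ·ᶜ (d ∷ ds) = c * d ∷ c ·ᶜ ds

_*ᶜ_ : List ℕ → List ℕ → List ℕ
[] *ᶜ ds = []
(c ∷ cs) *ᶜ ds = (c ·ᶜ ds) +ᶜ (0 ∷ cs *ᶜ ds)

coefficients : Poly → List ℕ
coefficients var = 0 ∷ 1 ∷ []
coefficients (con c) = c ∷ []
coefficients (e ⊕ e′) = coefficients e +ᶜ coefficients e′
coefficients (e ⊗ e′) = coefficients e *ᶜ coefficients e′

horner-+ᶜ : ∀ cs ds t → horner (cs +ᶜ ds) t ≡ horner cs t + horner ds t
horner-+ᶜ [] ds t = refl
horner-+ᶜ (c ∷ cs) [] t = sym (+-identityʳ _)
horner-+ᶜ (c ∷ cs) (d ∷ ds) t rewrite horner-+ᶜ cs ds t = regroup c d t (horner cs t) (horner ds t)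
  where regroup : ∀ c d t x y → c + d + t * (x + y) ≡ c + t * x + (d + t * y)
        regroup = solve-∀

horner-·ᶜ : ∀ c ds t → horner (c ·ᶜ ds) t ≡ c * horner ds t
horner-·ᶜ c [] t = sym (*-zeroʳ c)
horner-·ᶜ c (d ∷ ds) t rewrite horner-·ᶜ c ds t = regroup c d t (horner ds t)
  where regroup : ∀ c d t x → c * d + t * (c * x) ≡ c * (d + t * x)
        regroup = solve-∀

horner-*ᶜ : ∀ cs ds t → horner (cs *ᶜ ds) t ≡ horner cs t * horner ds t
horner-*ᶜ [] ds t = refl
horner-*ᶜ (c ∷ cs) ds t rewrite horner-+ᶜ (c ·ᶜ ds) (0 ∷ cs *ᶜ ds) t | horner-·ᶜ c ds t | horner-*ᶜ cs ds t =
  regroup c t (horner cs t) (horner ds t)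
  where regroup : ∀ c t x y → c * y + t * (x * y) ≡ (c + t * x) * y
        regroup = solve-∀

horner-coefficients : ∀ e t → horner (coefficients e) t ≡ eval e t
horner-coefficients var t = trans (cong (t *_) (cong suc (*-zeroʳ t))) (*-identityʳ t)
horner-coefficients (con c) t = trans (cong (c +_) (*-zeroʳ t)) (+-identityʳ c)
horner-coefficients (e ⊕ e′) t = trans (horner-+ᶜ (coefficients e) (coefficients e′) t)
  (cong₂ _+_ (horner-coefficients e t) (horner-coefficients e′ t))
horner-coefficients (e ⊗ e′) t = trans (horner-*ᶜ (coefficients e) (coefficients e′) t)
  (cong₂ _*_ (horner-coefficients e t) (horner-coefficients e′ t))

_≤ᶜ_ : List ℕ → List ℕ → Bool
[] ≤ᶜ ds = true
(c ∷ cs) ≤ᶜ [] = (c ≤ᵇ 0) ∧ (cs ≤ᶜ [])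
(c ∷ cs) ≤ᶜ (d ∷ ds) = (c ≤ᵇ d) ∧ (cs ≤ᶜ ds)

horner-mono : ∀ cs ds t → T (cs ≤ᶜ ds) → horner cs t ≤ horner ds t
horner-mono [] ds t _ = z≤n
horner-mono (c ∷ cs) [] t cs≤ with Equivalence.to (Boolₚ.T-∧ {c ≤ᵇ 0}) cs≤
... | c≤0 , cs≤0 =
  +-mono-≤ (≤ᵇ⇒≤ c 0 c≤0) (≤-trans (*-monoʳ-≤ t (horner-mono cs [] t cs≤0)) (≤-reflexive (*-zeroʳ t)))
horner-mono (c ∷ cs) (d ∷ ds) t cs≤ with Equivalence.to (Boolₚ.T-∧ {c ≤ᵇ d}) cs≤
... | c≤d , cs≤ds = +-mono-≤ (≤ᵇ⇒≤ c d c≤d) (*-monoʳ-≤ t (horner-mono cs ds t cs≤ds))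

eval-mono : ∀ e e′ → T (coefficients e ≤ᶜ coefficients e′) → ∀ t → eval e t ≤ eval e′ t
eval-mono e e′ e≤e′ t = subst₂ _≤_ (horner-coefficients e t) (horner-coefficients e′ t)
  (horner-mono (coefficients e) (coefficients e′) t e≤e′)

quartic : Poly → Poly → Poly
quartic a′ r′ =
  (a ⊗ a′) ⊗ (a ⊗ a′) ⊕ con 4 ⊗ (a ⊗ a′) ⊗ (a ⊗ r) ⊕ con 2 ⊗ ((a ⊕ a) ⊗ (a′ ⊕ a)) ⊗ r ⊕ con 4 ⊗ a ⊗ (r ⊗ r′)
  where
  a r : Poly
  a = con 1 ⊕ a′
  r = con 1 ⊕ r′

four-exhibitedEdges : ∀ a′ r′ t → 4 * exhibitedEdges (suc a′) (suc a′) (suc r′) ≡ eval (quartic (con a′) (con r′)) t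
four-exhibitedEdges a′ r′ t = begin
  4 * exhibitedEdges a a r
    ≡⟨ expand a r (pairs a) (pairs (a + a)) (pairs r) ⟩
  2 * pairs a * (2 * pairs a) + 4 * (2 * pairs a) * (a * r) + 2 * (2 * pairs (a + a)) * r + 4 * a * (2 * pairs r)
    ≡⟨ cong₂ (λ x z → x * x + 4 * x * (a * r) + 2 * (2 * pairs (a + a)) * r + 4 * a * z) (pairs-double a′) (pairs-double r′) ⟩
  a * a′ * (a * a′) + 4 * (a * a′) * (a * r) + 2 * (2 * pairs (a + a)) * r + 4 * a * (r * r′)
    ≡⟨ cong (λ y → a * a′ * (a * a′) + 4 * (a * a′) * (a * r) + 2 * y * r + 4 * a * (r * r′)) (pairs-double (a′ + a)) ⟩
  eval (quartic (con a′) (con r′)) t ∎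
  where
  open ≡-Reasoning
  a r : ℕ
  a = suc a′
  r = suc r′
  expand : ∀ A R P Q S → 4 * (P * P + (P * (A * R) + (A * R * P + (Q * R + (A + A) * S))))
                       ≡ 2 * P * (2 * P) + 4 * (2 * P) * (A * R) + 2 * (2 * Q) * R + 4 * A * (2 * S)
  expand = solve-∀

ManyEdges : ℕ → Set
ManyEdges n = Σ (Graph n) λ G → ∃ λ L → EdgeList G L × (n ^ 4 ≤ 54 * length L)

construction-manyEdges : ∀ p q r → 0 < p → 0 < r → (p + q + r) ^ 4 ≤ 54 * exhibitedEdges p q r → ManyEdges (p + q + r)
construction-manyEdges p q r p>0 r>0 n⁴≤ =
  graph , edgeList , edgeList-isEdgeList , subst (λ m → (p + q + r) ^ 4 ≤ 54 * m) (sym length-edgeList) n⁴≤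
  where open Construction p q r p>0 r>0

fourthPower : Poly → Poly
fourthPower x = x ⊗ (x ⊗ (x ⊗ (x ⊗ con 1)))

balanced-manyEdges : ∀ α β →
  T (coefficients (con 4 ⊗ fourthPower (con 7 ⊗ var ⊕ con (2 * α + β + 3)))
     ≤ᶜ coefficients (con 54 ⊗ quartic (con 3 ⊗ var ⊕ con α) (var ⊕ con β))) →
  ∀ t → ManyEdges (7 * t + (2 * α + β + 3))
balanced-manyEdges α β dominated t =
  subst ManyEdges (size t α β) (construction-manyEdges a a r z<s z<s (*-cancelˡ-≤ 4 (begin
    4 * (a + a + r) ^ 4                          ≡⟨ cong (λ m → 4 * m ^ 4) (size t α β) ⟩
    4 * (7 * t + (2 * α + β + 3)) ^ 4            ≤⟨ eval-mono (con 4 ⊗ fourthPower (con 7 ⊗ var ⊕ con (2 * α + β + 3)))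
                                                 (con 54 ⊗ quartic (con 3 ⊗ var ⊕ con α) (var ⊕ con β)) dominated t ⟩
    54 * eval (quartic (con (3 * t + α)) (con (t + β))) t ≡⟨ cong (54 *_) (four-exhibitedEdges (3 * t + α) (t + β) t) ⟨
    54 * (4 * exhibitedEdges a a r)              ≡⟨ *-comm-middle 54 4 (exhibitedEdges a a r) ⟩
    4 * (54 * exhibitedEdges a a r)              ∎)))
  where
  open ≤-Reasoning
  a r : ℕ
  a = suc (3 * t + α)
  r = suc (t + β)
  size : ∀ t α β → suc (3 * t + α) + suc (3 * t + α) + suc (t + β) ≡ 7 * t + (2 * α + β + 3)
  size = solve-∀
  *-comm-middle : ∀ x y z → x * (y * z) ≡ y * (x * z)
  *-comm-middle = solve-∀

-- Each residue uses p = q = 3t + α + 1 and r = t + β + 1, i.e. p ≈ 3n/7 and r ≈ n/7; for n = 7 no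
-- choice with p = q works and (p, q, r) = (2, 3, 2) is used instead.
manyEdges-residue : ∀ s t → s < 7 → ManyEdges (7 * t + (6 + s))
manyEdges-residue 0 t _ = balanced-manyEdges 1 1 tt t
manyEdges-residue 1 zero _ = construction-manyEdges 2 3 2 z<s z<s (≤ᵇ⇒≤ _ _ tt)
manyEdges-residue 1 (suc t) _ = subst ManyEdges (shift t) (balanced-manyEdges 4 3 tt t)
  where shift : ∀ t → 7 * t + 14 ≡ 7 * suc t + 7
        shift = solve-∀
manyEdges-residue 2 t _ = balanced-manyEdges 2 1 tt t
manyEdges-residue 3 t _ = balanced-manyEdges 2 2 tt t
manyEdges-residue 4 t _ = balanced-manyEdges 3 1 tt t
manyEdges-residue 5 t _ = balanced-manyEdges 3 2 tt t
manyEdges-residue 6 t _ = balanced-manyEdges 3 3 tt t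
manyEdges-residue (suc (suc (suc (suc (suc (suc (suc s))))))) t (s≤s (s≤s (s≤s (s≤s (s≤s (s≤s (s≤s ())))))))

lowerBound : ∀ n → 6 ≤ n → ManyEdges n
lowerBound n 6≤n = subst ManyEdges n≡ (manyEdges-residue (m % 7) (m / 7) (m%n<n m 7))
  where
  m : ℕ
  m = n ∸ 6
  n≡ : 7 * (m / 7) + (6 + m % 7) ≡ n
  n≡ = trans (regroup (m % 7) (m / 7)) (trans (cong (6 +_) (sym (m≡m%n+[m/n]*n m 7))) (m+[n∸m]≡n 6≤n))
    where regroup : ∀ s t → 7 * t + (6 + s) ≡ 6 + (s + t * 7)
          regroup = solve-∀

theorem3p5 :
    -- lower bound: for n ≥ 6, g(n) ≥ n⁴/54
    (∀ n → 6 ≤ n →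
      Σ (Graph n) λ G → ∃ λ L → EdgeList G L × (n ^ 4 ≤ 54 * length L))
    ×
    -- upper bound: g(n) ≤ (1/32 + ε) n⁴ for every ε = 1/(k+1) and all large n
    (∀ k → ∃ λ N → ∀ n → N ≤ n → ∀ (G : Graph n) L → EdgeList G L →
      32 * suc k * length L ≤ (suc k + 32) * n ^ 4)
theorem3p5 = lowerBound , λ k → suc k , λ n k<n G L edges → upperBound-asymptotic k k<n (upperBound G edges)
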